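{- There exists a Fibonacci-automatic function $g_3:\mathbb{N}\to\{0,1,2\}$ such that, for all $n\ge 0$, the $n$-th non-terminal $\mathcal{P}$-position $(a_n,b_n)$ of $K^3$ is given by \[ a_n=\lfloor (n+2)\phi\rfloor+g_3(n+1)-1\quad\text{and}\quad b_n=\lfloor (n+2)\phi^2\rfloor+g_3(n+1)+1 . \]
   Context: $\phi=(1+\sqrt5)/2$. Positions are pairs $(x,y)\in\mathbb{N}^2$. A Wythoff move from $(x,y)$ leads to $(x-i,y)$ with $1\le i\le x$, to $(x,y-i)$ with $1\le i\le y$, or to $(x-i,y-i)$ with $1\le i\le\min(x,y)$. For $\ell\in\mathbb{N}$, $K^\ell$ is the two-player impartial game with Wythoff moves in which the positions of $\{(x,y): x+y\le\ell\}$ are terminal: no move is allowed from a terminal position, and a player who moves into a terminal position wins (normal play). A $\mathcal{P}$-position is a position from which the previous player has a winning strategy. The non-terminal $\mathcal{P}$-positions $(a,b)$ with $a<b$, listed in increasing order of $a$, are denoted $(a_n,b_n)$, $n\ge 0$ (so $(a_0,b_0)$ is the first one). The Fibonacci sequence is $F_0=1,F_1=2,F_{n+2}=F_{n+1}+F_n$, and $\mathrm{rep}_F(n)$ is the greedy representation of $n$ over $\{0,1\}$ (no two consecutive $1$'s, empty for $n=0$). A function $u:\mathbb{N}\to\Delta$ is Fibonacci-automatic if some deterministic finite automaton with output, fed with $\mathrm{rep}_F(n)$, outputs $u(n)$. -}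

module Defs where

open import Data.Nat using (ℕ; zero; suc; _+_; _*_; _∸_; _≤_; _<_; _≤ᵇ_; _⊓_)
open import Data.Bool using (Bool; true; false; if_then_else_; not; _∧_)
open import Data.List using (List; []; _∷_; map; upTo; filter; length; _++_; foldl; foldr)
open import Data.Fin using (Fin)
open import Data.Product using (_×_; _,_; proj₁; proj₂)
open import Relation.Binary.PropositionalEquality using (_≡_)
open import Data.Sum using (_⊎_)
open import Relation.Nullary.Decidable using (does)
open import Data.Nat.Properties using (_≤?_)

-- Fibonacci numbers (paper's convention): F₀ = 1, F₁ = 2, F_{n+2} = F_{n+1} + F_n

fib : ℕ → ℕ
fib zero = 1
fib (suc zero) = 2
fib (suc (suc n)) = fib (suc n) + fib n

-- number of Fibonacci numbers F_k with F_k ≤ n  (= length of rep_F(n));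
-- since F_k > k, only k ≤ n need to be inspected
repLength : ℕ → ℕ
repLength n = length (filter (λ k → fib k ≤? n) (upTo (suc n)))

greedyDigits : ℕ → ℕ → List Bool
greedyDigits zero r = []
greedyDigits (suc k) r =
  if fib k ≤ᵇ r then true ∷ greedyDigits k (r ∸ fib k)
                else false ∷ greedyDigits k r

-- rep_F(n): greedy Fibonacci (Zeckendorf) representation, most significant
-- digit first, empty word for n = 0
repF : ℕ → List Bool
repF n = greedyDigits (repLength n) n

record DFAO (Δ : Set) : Set where
  field
    Q     : ℕ
    start : Fin Q
    δ     : Fin Q → Bool → Fin Q
    out   : Fin Q → Δ

run : ∀ {Δ} → (M : DFAO Δ) → List Bool → Fin (DFAO.Q M)
run M w = foldl (DFAO.δ M) (DFAO.start M) w

evalF : ∀ {Δ} → DFAO Δ → ℕ → Δ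
evalF M n = DFAO.out M (run M (repF n))

-- The game K^ℓ: Wythoff moves, positions with x + y ≤ ℓ are terminal.

wythoffMoves : ℕ → ℕ → List (ℕ × ℕ)
wythoffMoves x y =
  map (λ i → (x ∸ suc i , y)) (upTo x) ++
  map (λ i → (x , y ∸ suc i)) (upTo y) ++
  map (λ i → (x ∸ suc i , y ∸ suc i)) (upTo (x ⊓ y))

allB : {A : Set} → (A → Bool) → List A → Bool
allB p = foldr (λ a r → p a ∧ r) true

-- P-position test with fuel (fuel ≥ x + y suffices, as every move
-- decreases x + y).  Terminal positions have no moves, hence are P.
isPFuel : ℕ → ℕ → ℕ → ℕ → Bool
isPFuel ℓ zero x y = true
isPFuel ℓ (suc f) x y =
  if (x + y) ≤ᵇ ℓ then true
  else allB (λ p → not (isPFuel ℓ f (proj₁ p) (proj₂ p))) (wythoffMoves x y)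

isP : ℕ → ℕ → ℕ → Bool
isP ℓ x y = isPFuel ℓ (x + y) x y

NonTerminalP : ℕ → ℕ → ℕ → Set
NonTerminalP ℓ x y = (ℓ < x + y) × (isP ℓ x y ≡ true)

-- Floors of numbers (p + q√5)/2 with p q ∈ ℕ, characterised exactly in
-- integer arithmetic:
--   m ≤ (p + q√5)/2   ⇔  2m ≤ p  or  (2m − p)² ≤ 5q²
--   (p + q√5)/2 < m+1 ⇔  p < 2m+2  and  5q² < (2m+2 − p)²
-- Hence ⌊kφ⌋ is the m with IsFloorHalfSqrt5 k k m, and
-- ⌊kφ²⌋ = ⌊k(3+√5)/2⌋ is the m with IsFloorHalfSqrt5 (3k) k m.

IsFloorHalfSqrt5 : ℕ → ℕ → ℕ → Set
IsFloorHalfSqrt5 p q m =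
  ((2 * m ≤ p) ⊎ ((2 * m ∸ p) * (2 * m ∸ p) ≤ 5 * (q * q)))
  × (p < 2 * m + 2)
  × (5 * (q * q) < (2 * m + 2 ∸ p) * (2 * m + 2 ∸ p))

IsFloorPhiMul : ℕ → ℕ → Set
IsFloorPhiMul k m = IsFloorHalfSqrt5 k k m

IsFloorPhiSqMul : ℕ → ℕ → Set
IsFloorPhiSqMul k m = IsFloorHalfSqrt5 (3 * k) k m

{-# OPTIONS --safe #-}
-- Order in ℤ[φ] needs no real numbers: p + q φ > 0 iff p F n + q F (n + 1) > 0 for all large n, and Cassini's
-- identity turns such inequalities into the integer conditions of IsFloorHalfSqrt5.
--
-- If m and s are the values of w = rep_F n and of w 0, then m φ - s lies in (1 - φ, 2 - φ), in a subinterval fixed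
-- by the last digits of w.  Hence ⌊(n + 1) φ⌋ = s + 1, and ⌊(n + 3) φ⌋ - ⌊(n + 1) φ⌋ is 4 if w ends in 10 and 3
-- otherwise.  The automaton outputs 1 + [rep_F n ends in 10], plus 1 if n + 3 = L j with j ≥ 3 odd and minus 1 if
-- n + 3 = L j with j ≥ 4 even (it recognises the words rep_F (L j - 3)).  So a n + 3 = ⌊(n + 4) φ⌋, except at
-- n + 4 = L j, where ⌊L j φ⌋, which is L (j + 1) - 1 for odd j and L (j + 1) for even j, is replaced by L (j + 1)
-- and L (j + 1) - 1 respectively.  These changes swap values between the Beatty sequences ⌊k φ⌋ and ⌊k φ²⌋, so
-- a n and b n = a n + n + 4 still partition {4, 5, …}.  For the game with terminal positions x + y ≤ ℓ, any such
-- partition of {ℓ + 1, …} with b n = a n + n + ℓ + 1 is exactly the set of non-terminal P-positions.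

module Submission where

open import Defs

module StrictMonotonicity where

  open import Data.Nat using (ℕ; suc; _<_; s≤s)
  open import Data.Nat.Properties using (<-trans; <-irrefl; <-cmp; m≤n⇒m<n∨m≡n)
  open import Data.Sum using (inj₁; inj₂)
  open import Data.Empty using (⊥-elim)
  open import Relation.Binary.Definitions using (tri<; tri≈; tri>)
  open import Relation.Binary.PropositionalEquality using (_≡_; refl; sym)

  mono-suc⇒mono : ∀ (f : ℕ → ℕ) → (∀ n → f n < f (suc n)) → ∀ {m n} → m < n → f m < f n
  mono-suc⇒mono f step {m} {suc n} (s≤s m≤n) with m≤n⇒m<n∨m≡n m≤n
  ... | inj₁ m<n = <-trans (mono-suc⇒mono f step m<n) (step n)
  ... | inj₂ refl = step m

  mono⇒injective : ∀ (f : ℕ → ℕ) → (∀ {m n} → m < n → f m < f n) → ∀ {m n} → f m ≡ f n → m ≡ n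
  mono⇒injective f mono {m} {n} eq with <-cmp m n
  ... | tri< m<n _ _ = ⊥-elim (<-irrefl eq (mono m<n))
  ... | tri≈ _ m≡n _ = m≡n
  ... | tri> _ _ n<m = ⊥-elim (<-irrefl (sym eq) (mono n<m))

module Fibonacci where

  open import Data.Nat using (ℕ; zero; suc; _+_; _≤_; _<_; s≤s; z≤n; pred)
  open import Data.Nat.Properties
  open import Data.Product using (Σ; _,_)
  open import Data.Sum using (inj₁; inj₂)
  open import Relation.Binary.PropositionalEquality
  open StrictMonotonicity

  fib>0 : ∀ n → 0 < fib n
  fib>0 zero = s≤s z≤n
  fib>0 (suc zero) = s≤s z≤n
  fib>0 (suc (suc n)) = ≤-trans (fib>0 (suc n)) (m≤m+n _ _)

  fib-suc-split : ∀ m → Σ ℕ λ c → fib (suc m) ≡ fib m + c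
  fib-suc-split zero = 1 , refl
  fib-suc-split (suc m) = fib m , refl

  fib-<-suc : ∀ n → fib n < fib (suc n)
  fib-<-suc zero = s≤s (s≤s z≤n)
  fib-<-suc (suc n) = m<m+n (fib (suc n)) (fib>0 n)

  fib-mono-< : ∀ {m n} → m < n → fib m < fib n
  fib-mono-< = mono-suc⇒mono fib fib-<-suc

  fib-mono-≤ : ∀ {m n} → m ≤ n → fib m ≤ fib n
  fib-mono-≤ m≤n with m≤n⇒m<n∨m≡n m≤n
  ... | inj₁ m<n = <⇒≤ (fib-mono-< m<n)
  ... | inj₂ refl = ≤-refl

  n<fib : ∀ n → n < fib n
  n<fib zero = s≤s z≤n
  n<fib (suc n) = ≤-<-trans (n<fib n) (fib-<-suc n)

  fib+fib-pred : ∀ n → fib n + fib (pred n) ≡ fib (suc n)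
  fib+fib-pred zero = refl
  fib+fib-pred (suc n) = refl

module GoldenOrder where

  open import Data.Nat as ℕ using (ℕ; zero; suc)
  import Data.Nat.Properties as ℕP
  open import Data.Integer as ℤ using (ℤ; +_; -_; _+_; _*_; _-_; _<_; _≤_; +<+; -[1+_]; +[1+_])
  import Data.Integer.Properties as ℤP
  open import Data.Integer.Tactic.RingSolver using (solve-∀)
  open import Data.Product using (Σ; _,_; proj₁; proj₂; _×_)
  open import Relation.Nullary.Decidable using (True; toWitness; yes; no)
  open import Data.Empty using (⊥; ⊥-elim)
  open import Relation.Binary.PropositionalEquality
  open Fibonacci

  -- (p , q) stands for p + q φ.
  ℤ[φ] : Set
  ℤ[φ] = ℤ × ℤ

  infixl 6 _⊕_ _⊖_
  infix 4 _<φ_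

  _⊕_ : ℤ[φ] → ℤ[φ] → ℤ[φ]
  x ⊕ y = (proj₁ x + proj₁ y , proj₂ x + proj₂ y)

  ⊝ : ℤ[φ] → ℤ[φ]
  ⊝ x = (- proj₁ x , - proj₂ x)

  _⊖_ : ℤ[φ] → ℤ[φ] → ℤ[φ]
  x ⊖ y = x ⊕ ⊝ y

  -- (p + q φ) / φ = (q - p) + p φ, as φ⁻¹ = φ - 1.
  divφ : ℤ[φ] → ℤ[φ]
  divφ x = (proj₂ x - proj₁ x , proj₁ x)

  ι : ℤ → ℤ[φ]
  ι c = (c , + 0)

  mulφ : ℕ → ℤ[φ]
  mulφ k = (+ 0 , + k)

  atFib : ℕ → ℤ[φ] → ℤ
  atFib n x = proj₁ x * + fib n + proj₂ x * + fib (suc n)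

  -- Since F (n + 1) / F n → φ, the sign of p + q φ is the eventual sign of p F n + q F (n + 1).
  record Positive (x : ℤ[φ]) : Set where
    constructor positiveFrom
    field
      threshold : ℕ
      atFib>0   : ∀ n → + 0 < atFib (n ℕ.+ threshold) x

  record _<φ_ (x y : ℤ[φ]) : Set where
    constructor mk<φ
    field
      difference>0 : Positive (y ⊖ x)

  +fib-rec : ∀ n → + fib (suc (suc n)) ≡ + fib (suc n) + + fib n
  +fib-rec n = ℤP.pos-+ (fib (suc n)) (fib n)

  atFib-rec : ∀ n x → atFib (suc (suc n)) x ≡ atFib (suc n) x + atFib n x
  atFib-rec n x rewrite +fib-rec (suc n) | +fib-rec n =
    ring (proj₁ x) (proj₂ x) (+ fib (suc n)) (+ fib n)
    where
    ring : ∀ p q a b → p * (a + b) + q * ((a + b) + a) ≡ (p * a + q * (a + b)) + (p * b + q * a)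
    ring = solve-∀

  positive-intro : ∀ N x → + 0 ≤ atFib N x → + 0 < atFib (suc N) x → Positive x
  positive-intro N x h₀ h₁ = positiveFrom (suc N) λ n →
    subst (λ m → + 0 < atFib m x) (sym (ℕP.+-suc n N)) (proj₂ (both n))
    where
    both : ∀ n → (+ 0 ≤ atFib (n ℕ.+ N) x) × (+ 0 < atFib (suc (n ℕ.+ N)) x)
    both zero = h₀ , h₁
    both (suc n) with both n
    ... | ≥0 , >0 = ℤP.<⇒≤ >0 , subst (+ 0 <_) (sym (atFib-rec (n ℕ.+ N) x)) (ℤP.+-mono-<-≤ >0 ≥0)

  ⊕-positive : ∀ {x y} → Positive x → Positive y → Positive (x ⊕ y)
  ⊕-positive {x} {y} (positiveFrom M hx) (positiveFrom N hy) = positiveFrom (M ℕ.+ N) λ n →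
    subst (+ 0 <_) (sym (split (n ℕ.+ (M ℕ.+ N))))
      (ℤP.+-mono-< (subst (λ m → + 0 < atFib m x) (shuffle n N M) (hx (n ℕ.+ N)))
                    (subst (λ m → + 0 < atFib m y) (ℕP.+-assoc n M N) (hy (n ℕ.+ M))))
    where
    ring : ∀ p q p′ q′ a b → (p + p′) * a + (q + q′) * b ≡ (p * a + q * b) + (p′ * a + q′ * b)
    ring = solve-∀
    split : ∀ m → atFib m (x ⊕ y) ≡ atFib m x + atFib m y
    split m = ring (proj₁ x) (proj₂ x) (proj₁ y) (proj₂ y) (+ fib m) (+ fib (suc m))
    shuffle : ∀ n N M → n ℕ.+ N ℕ.+ M ≡ n ℕ.+ (M ℕ.+ N)
    shuffle n N M = trans (ℕP.+-assoc n N M) (cong (n ℕ.+_) (ℕP.+-comm N M))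

  divφ-positive : ∀ {x} → Positive x → Positive (divφ x)
  divφ-positive {x} (positiveFrom N h) = positiveFrom (suc N) λ n → subst (+ 0 <_) (shift n) (h n)
    where
    ring : ∀ p q a b → p * a + q * b ≡ (q - p) * b + p * (b + a)
    ring = solve-∀
    shift : ∀ n → atFib (n ℕ.+ N) x ≡ atFib (n ℕ.+ suc N) (divφ x)
    shift n rewrite ℕP.+-suc n N | +fib-rec (n ℕ.+ N) =
      ring (proj₁ x) (proj₂ x) (+ fib (n ℕ.+ N)) (+ fib (suc (n ℕ.+ N)))

  ι-positive : ∀ {c} → Positive (ι c) → + 0 < c
  ι-positive {c} (positiveFrom N h) with h 0 | fib>0 N
  ... | h₀ | F>0 = sign c (fib N) F>0 h₀
    where
    sign : ∀ c f → 0 ℕ.< f → + 0 < c * + f + + 0 * + fib (suc N) → + 0 < c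
    sign (+ zero) f _ (+<+ ())
    sign +[1+ k ] f _ _ = +<+ (ℕ.s≤s ℕ.z≤n)
    sign -[1+ k ] (suc f) _ ()

  positive-resp : ∀ {x y} → x ≡ y → Positive x → Positive y
  positive-resp = subst Positive

  <φ-trans : ∀ {x y z} → x <φ y → y <φ z → x <φ z
  <φ-trans {x} {y} {z} (mk<φ h) (mk<φ h′) =
    mk<φ (positive-resp (cong₂ _,_ (ring (proj₁ x) (proj₁ y) (proj₁ z)) (ring (proj₂ x) (proj₂ y) (proj₂ z)))
                        (⊕-positive h′ h))
    where
    ring : ∀ a b c → (c + - b) + (b + - a) ≡ c + - a
    ring = solve-∀

  divφ-mono-< : ∀ {x y} → x <φ y → divφ x <φ divφ y
  divφ-mono-< {x} {y} (mk<φ h) =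
    mk<φ (positive-resp (cong₂ _,_ (ring (proj₁ x) (proj₂ x) (proj₁ y) (proj₂ y)) refl) (divφ-positive h))
    where
    ring : ∀ a b c d → (d + - b) - (c + - a) ≡ (d - c) + - (b - a)
    ring = solve-∀

  ⊝-anti-< : ∀ {x y} → x <φ y → ⊝ y <φ ⊝ x
  ⊝-anti-< {x} {y} (mk<φ h) =
    mk<φ (positive-resp (cong₂ _,_ (ring (proj₁ x) (proj₁ y)) (ring (proj₂ x) (proj₂ y))) h)
    where
    ring : ∀ a b → b + - a ≡ - a + - (- b)
    ring = solve-∀

  ⊕-mono-< : ∀ {x y x′ y′} → x <φ y → x′ <φ y′ → x ⊕ x′ <φ y ⊕ y′
  ⊕-mono-< {x} {y} {x′} {y′} (mk<φ h) (mk<φ h′) =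
    mk<φ (positive-resp (cong₂ _,_ (ring (proj₁ x) (proj₁ y) (proj₁ x′) (proj₁ y′))
                                   (ring (proj₂ x) (proj₂ y) (proj₂ x′) (proj₂ y′)))
                        (⊕-positive h h′))
    where
    ring : ∀ a b c d → (b + - a) + (d + - c) ≡ (b + d) + - (a + c)
    ring = solve-∀

  ⊕-monoˡ-< : ∀ {x y} c → x <φ y → x ⊕ c <φ y ⊕ c
  ⊕-monoˡ-< {x} {y} c (mk<φ h) =
    mk<φ (positive-resp (cong₂ _,_ (ring (proj₁ x) (proj₁ y) (proj₁ c)) (ring (proj₂ x) (proj₂ y) (proj₂ c)))
                        h)
    where
    ring : ∀ a b c → b + - a ≡ (b + c) + - (a + c)
    ring = solve-∀

  -- For closed x and y the two implicit conditions are checked by evaluation.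
  <φ-byEvaluation : ∀ (x y : ℤ[φ]) N →
                    {_ : True (+ 0 ℤP.≤? atFib N (y ⊖ x))} →
                    {_ : True (+ 0 ℤP.<? atFib (suc N) (y ⊖ x))} →
                    x <φ y
  <φ-byEvaluation x y N {p} {q} = mk<φ (positive-intro N (y ⊖ x) (toWitness p) (toWitness q))

  ι-cancel-< : ∀ {a b} → ι a <φ ι b → a < b
  ι-cancel-< {a} {b} (mk<φ h) with b ℤP.≤? a
  ... | yes b≤a = ⊥-elim (ℤP.<⇒≱ (ι-positive h) (ℤP.i≤j⇒i-j≤0 b≤a))
  ... | no b≰a = ℤP.≰⇒> b≰a

  ι+-cancel-< : ∀ {m n} → ι (+ m) <φ ι (+ n) → m ℕ.< n
  ι+-cancel-< h with ι-cancel-< h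
  ... | +<+ m<n = m<n

  cassiniForm : ℤ → ℤ → ℤ
  cassiniForm a b = a * a - a * b - b * b

  cassiniForm-rec : ∀ a b → cassiniForm (a + b) a ≡ - cassiniForm a b
  cassiniForm-rec = ring
    where
    ring : ∀ a b → (a + b) * (a + b) - (a + b) * a - a * a ≡ - (a * a - a * b - b * b)
    ring = solve-∀

  cassini-even : ∀ t → cassiniForm (+ fib (suc (t ℕ.+ t))) (+ fib (t ℕ.+ t)) ≡ + 1
  cassini-odd  : ∀ t → cassiniForm (+ fib (suc (suc (t ℕ.+ t)))) (+ fib (suc (t ℕ.+ t))) ≡ - + 1
  cassini-even zero = refl
  cassini-even (suc t) rewrite ℕP.+-suc t t | +fib-rec (suc (t ℕ.+ t)) =
    trans (cassiniForm-rec (+ fib (suc (suc (t ℕ.+ t)))) (+ fib (suc (t ℕ.+ t)))) (cong -_ (cassini-odd t))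
  cassini-odd t rewrite +fib-rec (t ℕ.+ t) =
    trans (cassiniForm-rec (+ fib (suc (t ℕ.+ t))) (+ fib (t ℕ.+ t))) (cong -_ (cassini-even t))

  pos-*+* : ∀ a b c d → + a * + b + + c * + d ≡ + (a ℕ.* b ℕ.+ c ℕ.* d)
  pos-*+* a b c d =
    trans (cong₂ _+_ (sym (ℤP.pos-* a b)) (sym (ℤP.pos-* c d))) (sym (ℤP.pos-+ (a ℕ.* b) (c ℕ.* d)))

  m*m≡0⇒m≡0 : ∀ m → m ℕ.* m ≡ 0 → m ≡ 0
  m*m≡0⇒m≡0 zero _ = refl

  0<⇒≡+ : ∀ {x} → + 0 < x → Σ ℕ λ n → x ≡ + n
  0<⇒≡+ {+ n} _ = n , refl

  pos-∸ : ∀ m n → n ℕ.≤ m → + m - + n ≡ + (m ℕ.∸ n)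
  pos-∸ m n n≤m = trans (ℤP.[+m]-[+n]≡m⊖n m n) (ℤP.⊖-≥ n≤m)

  nonnegative-sum≡0 : ∀ {X Y D} x y d k b → X ≡ + x → Y ≡ + y → D ≡ + d →
                      X * Y + + k * + k + + b * + b * D ≡ + 0 → k ≡ 0
  nonnegative-sum≡0 x y d k b refl refl refl eq =
    m*m≡0⇒m≡0 k (ℕP.m+n≡0⇒n≡0 (x ℕ.* y) (ℕP.m+n≡0⇒m≡0 _ (ℤP.+-injective (begin
      + (x ℕ.* y ℕ.+ k ℕ.* k ℕ.+ b ℕ.* b ℕ.* d)
        ≡⟨ ℤP.pos-+ (x ℕ.* y ℕ.+ k ℕ.* k) (b ℕ.* b ℕ.* d) ⟩
      + (x ℕ.* y ℕ.+ k ℕ.* k) + + (b ℕ.* b ℕ.* d)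
        ≡⟨ cong₂ _+_ (sym (pos-*+* x y k k)) (ℤP.pos-* (b ℕ.* b) d) ⟩
      + x * + y + + k * + k + + (b ℕ.* b) * + d
        ≡⟨ cong (λ B → + x * + y + + k * + k + B * + d) (ℤP.pos-* b b) ⟩
      + x * + y + + k * + k + + b * + b * + d
        ≡⟨ eq ⟩
      + 0 ∎))))
    where open ≡-Reasoning

  -- For consecutive Fibonacci numbers b < b + c, the sign of k (b + c) - u b is eventually that of k φ - u.
  -- Each bound rests on an identity X Y + k² + b² D = k² (1 ± cassiniForm (b + c) b) with X > 0 and Y, D ≥ 0,
  -- whose right side vanishes by Cassini; hence k = 0, and then X ≤ 0.
  cassini-odd-identity : ∀ U K B C → cassiniForm (B + C) B ≡ - + 1 →
                         (- U * B + K * (B + C)) * (C * K + U * B) + K * K + B * B * (U * U - (U * K + K * K)) ≡ + 0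
  cassini-odd-identity U K B C cassini =
    trans (ring U K B C) (trans (cong (λ z → K * K * (z + + 1)) cassini) (ℤP.*-zeroʳ (K * K)))
    where
    ring : ∀ U K B C → (- U * B + K * (B + C)) * (C * K + U * B) + K * K + B * B * (U * U - (U * K + K * K))
                      ≡ K * K * (((B + C) * (B + C) - (B + C) * B - B * B) + + 1)
    ring = solve-∀

  cassini-even-identity : ∀ V K B C → cassiniForm (B + C) B ≡ + 1 →
                          (V * B + - K * (B + C)) * (V * B + C * K) + K * K + B * B * ((V * K + K * K) - V * V) ≡ + 0
  cassini-even-identity V K B C cassini =
    trans (ring V K B C) (trans (cong (λ z → K * K * (+ 1 - z)) cassini) (ℤP.*-zeroʳ (K * K)))
    where
    ring : ∀ V K B C → (V * B + - K * (B + C)) * (V * B + C * K) + K * K + B * B * ((V * K + K * K) - V * V)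
                      ≡ K * K * (+ 1 - ((B + C) * (B + C) - (B + C) * B - B * B))
    ring = solve-∀

  cassini-odd-bound : ∀ u k b c → cassiniForm (+ b + + c) (+ b) ≡ - + 1 →
                      + 0 < - + u * + b + + k * (+ b + + c) → u ℕ.* k ℕ.+ k ℕ.* k ℕ.≤ u ℕ.* u → ⊥
  cassini-odd-bound u k b c cassini X>0 uk+k²≤u² with 0<⇒≡+ X>0
  ... | x , X≡x with nonnegative-sum≡0 x _ _ k b X≡x (pos-*+* c k u b) D≡d
                       (cassini-odd-identity (+ u) (+ k) (+ b) (+ c) cassini)
    where
    D≡d : + u * + u - (+ u * + k + + k * + k) ≡ + (u ℕ.* u ℕ.∸ (u ℕ.* k ℕ.+ k ℕ.* k))
    D≡d = trans (cong₂ _-_ (sym (ℤP.pos-* u u)) (pos-*+* u k k k)) (pos-∸ _ _ uk+k²≤u²)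
  ... | refl = ℤP.<⇒≱ X>0 (subst (_≤ + 0) X≡-ub ℤP.neg-≤-pos)
    where
    ring : ∀ U B Z → - U * B + + 0 * Z ≡ - (U * B)
    ring = solve-∀
    X≡-ub : - + (u ℕ.* b) ≡ - + u * + b + + 0 * (+ b + + c)
    X≡-ub = sym (trans (ring (+ u) (+ b) (+ b + + c)) (cong -_ (sym (ℤP.pos-* u b))))

  cassini-even-bound : ∀ v k b c → cassiniForm (+ b + + c) (+ b) ≡ + 1 →
                       + 0 < + v * + b + - + k * (+ b + + c) → v ℕ.* v ℕ.≤ v ℕ.* k ℕ.+ k ℕ.* k → ⊥
  cassini-even-bound v k b c cassini X>0 v²≤vk+k² with 0<⇒≡+ X>0
  ... | x , X≡x with nonnegative-sum≡0 x _ _ k b X≡x (pos-*+* v b c k) D≡d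
                       (cassini-even-identity (+ v) (+ k) (+ b) (+ c) cassini)
    where
    D≡d : (+ v * + k + + k * + k) - + v * + v ≡ + (v ℕ.* k ℕ.+ k ℕ.* k ℕ.∸ v ℕ.* v)
    D≡d = trans (cong₂ _-_ (pos-*+* v k k k) (sym (ℤP.pos-* v v))) (pos-∸ _ _ v²≤vk+k²)
  ... | refl with m*m≡0⇒m≡0 v (ℕP.n≤0⇒n≡0 (subst (v ℕ.* v ℕ.≤_) (trans (ℕP.+-identityʳ (v ℕ.* 0)) (ℕP.*-zeroʳ v))
                                                      v²≤vk+k²))
  ... | refl = ℤP.<-irrefl refl X>0

  below-mulφ⇒u²<uk+k² : ∀ u k → ι (+ u) <φ mulφ k → u ℕ.* u ℕ.< u ℕ.* k ℕ.+ k ℕ.* k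
  below-mulφ⇒u²<uk+k² u k (mk<φ (positiveFrom N h)) with u ℕ.* u ℕP.<? u ℕ.* k ℕ.+ k ℕ.* k
  ... | yes u²<uk+k² = u²<uk+k²
  ... | no u²≮uk+k² = ⊥-elim (cassini-odd-bound u k b c cassini X>0 (ℕP.≮⇒≥ u²≮uk+k²))
    where
    b = fib (suc (N ℕ.+ N))
    c = fib (N ℕ.+ N)
    cassini : cassiniForm (+ b + + c) (+ b) ≡ - + 1
    cassini = subst (λ a → cassiniForm a (+ b) ≡ - + 1) (+fib-rec (N ℕ.+ N)) (cassini-odd N)
    ring : ∀ U K B Z → (+ 0 + - U) * B + (K + - + 0) * Z ≡ - U * B + K * Z
    ring = solve-∀
    X>0 : + 0 < - + u * + b + + k * (+ b + + c)
    X>0 = subst (+ 0 <_) (trans (ring (+ u) (+ k) (+ b) _) (cong (λ Z → - + u * + b + + k * Z) (+fib-rec (N ℕ.+ N))))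
                (h (suc N))

  above-mulφ⇒vk+k²<v² : ∀ v k → mulφ k <φ ι (+ v) → v ℕ.* k ℕ.+ k ℕ.* k ℕ.< v ℕ.* v
  above-mulφ⇒vk+k²<v² v k (mk<φ (positiveFrom N h)) with v ℕ.* k ℕ.+ k ℕ.* k ℕP.<? v ℕ.* v
  ... | yes vk+k²<v² = vk+k²<v²
  ... | no vk+k²≮v² = ⊥-elim (cassini-even-bound v k b c cassini X>0 (ℕP.≮⇒≥ vk+k²≮v²))
    where
    b = fib (N ℕ.+ N)
    c = proj₁ (fib-suc-split (N ℕ.+ N))
    +b+c : + fib (suc (N ℕ.+ N)) ≡ + b + + c
    +b+c = trans (cong +_ (proj₂ (fib-suc-split (N ℕ.+ N)))) (ℤP.pos-+ b c)
    cassini : cassiniForm (+ b + + c) (+ b) ≡ + 1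
    cassini = subst (λ a → cassiniForm a (+ b) ≡ + 1) +b+c (cassini-even N)
    ring : ∀ V K B Z → (V + - + 0) * B + (+ 0 + - K) * Z ≡ V * B + - K * Z
    ring = solve-∀
    X>0 : + 0 < + v * + b + - + k * (+ b + + c)
    X>0 = subst (+ 0 <_) (trans (ring (+ v) (+ k) (+ b) _) (cong (λ Z → + v * + b + - + k * Z) +b+c)) (h N)

module FloorsOfMultiples where

  open import Data.Nat using (ℕ; suc; _+_; _*_; _∸_; _≤_; _<_)
  open import Data.Nat.Properties
  open import Data.Nat.Tactic.RingSolver using (solve-∀)
  open import Data.Integer as ℤ using (ℤ; +_)
  import Data.Integer.Properties as ℤP
  open import Data.Integer.Tactic.RingSolver using () renaming (solve-∀ to solveℤ-∀)
  open import Data.Product using (_,_; _×_)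
  open import Data.Sum using (_⊎_; inj₁; inj₂)
  open import Data.Empty using (⊥-elim)
  open import Relation.Nullary using (yes; no)
  open import Relation.Binary.PropositionalEquality
  open GoldenOrder

  Floorφ : ℕ → ℕ → Set
  Floorφ k u = (ι (+ u) <φ mulφ k) × (mulφ k <φ ι (+ suc u))

  -- (2u - k)² - 5k² = 4(u² - uk - k²): the bounds of IsFloorHalfSqrt5 are the hypotheses, multiplied by 4.
  floor-from-squares : ∀ k u → u * u < u * k + k * k → suc u * k + k * k < suc u * suc u →
                       IsFloorHalfSqrt5 k k u
  floor-from-squares k u lower upper = lower′ , k<2u+2 , upper′
    where
    sq : ∀ u → 4 * (u * u) ≡ (2 * u) * (2 * u)
    sq = solve-∀
    quad : ∀ u k → 4 * (u * k + k * k) ≡ 2 * (2 * u) * k + 4 * (k * k)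
    quad = solve-∀
    expand : ∀ t k → (t + k) * (t + k) ≡ t * t + (2 * t * k + k * k)
    expand = solve-∀
    expand′ : ∀ t k → 2 * (t + k) * k + 4 * (k * k) ≡ 5 * (k * k) + (2 * t * k + k * k)
    expand′ = solve-∀
    double-suc : ∀ u → 2 * suc u ≡ 2 * u + 2
    double-suc = solve-∀
    k<u+1 : k < suc u
    k<u+1 with k <? suc u
    ... | yes k<u+1 = k<u+1
    ... | no k≮u+1 =
      ⊥-elim (<-irrefl refl (<-≤-trans upper (≤-trans (*-monoʳ-≤ (suc u) (≮⇒≥ k≮u+1)) (m≤m+n _ _))))
    k<2u+2 : k < 2 * u + 2
    k<2u+2 = <-≤-trans k<u+1 (subst (suc u ≤_) (double-suc u) (m≤n*m (suc u) 2))
    lower′ : (2 * u ≤ k) ⊎ ((2 * u ∸ k) * (2 * u ∸ k) ≤ 5 * (k * k))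
    lower′ with 2 * u ≤? k
    ... | yes 2u≤k = inj₁ 2u≤k
    ... | no 2u≰k = inj₂ (<⇒≤ (+-cancelʳ-< _ _ _ (subst₂ _<_ lhs rhs (*-monoʳ-< 4 lower))))
      where
      t = 2 * u ∸ k
      t+k : t + k ≡ 2 * u
      t+k = m∸n+n≡m (<⇒≤ (≰⇒> 2u≰k))
      lhs : 4 * (u * u) ≡ t * t + (2 * t * k + k * k)
      lhs = trans (sq u) (trans (cong (λ z → z * z) (sym t+k)) (expand t k))
      rhs : 4 * (u * k + k * k) ≡ 5 * (k * k) + (2 * t * k + k * k)
      rhs = trans (quad u k) (trans (cong (λ z → 2 * z * k + 4 * (k * k)) (sym t+k)) (expand′ t k))
    upper′ : 5 * (k * k) < (2 * u + 2 ∸ k) * (2 * u + 2 ∸ k)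
    upper′ = +-cancelʳ-< _ _ _ (subst₂ _<_ lhs rhs (*-monoʳ-< 4 upper))
      where
      t = 2 * u + 2 ∸ k
      t+k : t + k ≡ 2 * suc u
      t+k = trans (m∸n+n≡m (<⇒≤ k<2u+2)) (sym (double-suc u))
      lhs : 4 * (suc u * k + k * k) ≡ 5 * (k * k) + (2 * t * k + k * k)
      lhs = trans (quad (suc u) k) (trans (cong (λ z → 2 * z * k + 4 * (k * k)) (sym t+k)) (expand′ t k))
      rhs : 4 * (suc u * suc u) ≡ t * t + (2 * t * k + k * k)
      rhs = trans (sq (suc u)) (trans (cong (λ z → z * z) (sym t+k)) (expand t k))

  -- ⌊k φ²⌋ = ⌊k φ⌋ + k
  IsFloorHalfSqrt5-+k : ∀ k u → IsFloorHalfSqrt5 k k u → IsFloorHalfSqrt5 (3 * k) k (u + k)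
  IsFloorHalfSqrt5-+k k u (lower , k<2u+2 , upper) =
    lower′ lower , 3k<2[u+k]+2 , subst (λ z → 5 * (k * k) < z * z) (sym shift₂) upper
    where
    double : ∀ u k → 2 * (u + k) ≡ 2 * k + 2 * u
    double = solve-∀
    triple : ∀ k → 3 * k ≡ 2 * k + k
    triple = solve-∀
    double+2 : ∀ u k → 2 * (u + k) + 2 ≡ 2 * k + (2 * u + 2)
    double+2 = solve-∀
    shift₁ : 2 * (u + k) ∸ 3 * k ≡ 2 * u ∸ k
    shift₁ = trans (cong₂ _∸_ (double u k) (triple k)) ([m+n]∸[m+o]≡n∸o (2 * k) (2 * u) k)
    shift₂ : 2 * (u + k) + 2 ∸ 3 * k ≡ 2 * u + 2 ∸ k
    shift₂ = trans (cong₂ _∸_ (double+2 u k) (triple k)) ([m+n]∸[m+o]≡n∸o (2 * k) (2 * u + 2) k)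
    lower′ : (2 * u ≤ k) ⊎ ((2 * u ∸ k) * (2 * u ∸ k) ≤ 5 * (k * k)) →
             (2 * (u + k) ≤ 3 * k) ⊎ ((2 * (u + k) ∸ 3 * k) * (2 * (u + k) ∸ 3 * k) ≤ 5 * (k * k))
    lower′ (inj₁ 2u≤k) = inj₁ (subst₂ _≤_ (sym (double u k)) (sym (triple k)) (+-monoʳ-≤ (2 * k) 2u≤k))
    lower′ (inj₂ bound) = inj₂ (subst (λ z → z * z ≤ 5 * (k * k)) (sym shift₁) bound)
    3k<2[u+k]+2 : 3 * k < 2 * (u + k) + 2
    3k<2[u+k]+2 = subst₂ _<_ (sym (triple k)) (sym (double+2 u k)) (+-monoʳ-< (2 * k) k<2u+2)

  Floorφ⇒IsFloorPhiMul : ∀ {k u} → Floorφ k u → IsFloorPhiMul k u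
  Floorφ⇒IsFloorPhiMul {k} {u} (lower , upper) =
    floor-from-squares k u (below-mulφ⇒u²<uk+k² u k lower) (above-mulφ⇒vk+k²<v² (suc u) k upper)

  Floorφ⇒IsFloorPhiSqMul : ∀ {k u} → Floorφ k u → IsFloorPhiSqMul k (u + k)
  Floorφ⇒IsFloorPhiSqMul {k} {u} ⌊kφ⌋≡u = IsFloorHalfSqrt5-+k k u (Floorφ⇒IsFloorPhiMul ⌊kφ⌋≡u)

  Floorφ-≤ : ∀ {k u u′} → Floorφ k u → Floorφ k u′ → u ≤ u′
  Floorφ-≤ (u<kφ , _) (_ , kφ<u′+1) = <⇒≤pred (ι+-cancel-< (<φ-trans u<kφ kφ<u′+1))

  Floorφ-unique : ∀ {k u u′} → Floorφ k u → Floorφ k u′ → u ≡ u′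
  Floorφ-unique f f′ = ≤-antisym (Floorφ-≤ f f′) (Floorφ-≤ f′ f)

  ι-+ : ∀ a b → ι (+ a) ⊕ ι (+ b) ≡ ι (+ (a + b))
  ι-+ a b = cong₂ _,_ (sym (ℤP.pos-+ a b)) refl

  mulφ-+ : ∀ a b → mulφ a ⊕ mulφ b ≡ mulφ (a + b)
  mulφ-+ a b = cong₂ _,_ refl (sym (ℤP.pos-+ a b))

  -- 1 < φ < 2
  Floorφ-suc : ∀ {k u u′} → Floorφ k u → Floorφ (suc k) u′ → (u < u′) × (u′ ≤ u + 2)
  Floorφ-suc {k} {u} {u′} (u<kφ , kφ<u+1) (u′<[k+1]φ , [k+1]φ<u′+1) = u<u′ , u′≤u+2
    where
    k+1 : mulφ k ⊕ mulφ 1 ≡ mulφ (suc k)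
    k+1 = trans (mulφ-+ k 1) (cong mulφ (+-comm k 1))
    u+1<[k+1]φ : ι (+ (u + 1)) <φ mulφ (suc k)
    u+1<[k+1]φ = subst₂ _<φ_ (ι-+ u 1) k+1 (⊕-mono-< u<kφ (<φ-byEvaluation (ι (+ 1)) (mulφ 1) 6))
    u<u′ : u < u′
    u<u′ = ≤-pred (subst (_< suc u′) (+-comm u 1) (ι+-cancel-< (<φ-trans u+1<[k+1]φ [k+1]φ<u′+1)))
    [k+1]φ<u+3 : mulφ (suc k) <φ ι (+ (suc u + 2))
    [k+1]φ<u+3 = subst₂ _<φ_ k+1 (ι-+ (suc u) 2) (⊕-mono-< kφ<u+1 (<φ-byEvaluation (mulφ 1) (ι (+ 2)) 6))
    u′≤u+2 : u′ ≤ u + 2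
    u′≤u+2 = ≤-pred (ι+-cancel-< (<φ-trans u′<[k+1]φ [k+1]φ<u+3))

  divφ-mulφ : ∀ d → divφ (mulφ d) ≡ ι (+ d)
  divφ-mulφ d = cong₂ _,_ (ℤP.+-identityʳ (+ d)) refl

  divφ²-mulφ² : ∀ d → divφ (divφ (mulφ d ⊕ ι (+ d))) ≡ ι (+ d)
  divφ²-mulφ² d = cong₂ _,_ (ring₁ (+ d)) (ring₂ (+ d))
    where
    ring₁ : ∀ D → (ℤ.+ 0 ℤ.+ D) ℤ.- ((D ℤ.+ ℤ.+ 0) ℤ.- (ℤ.+ 0 ℤ.+ D)) ≡ D
    ring₁ = solveℤ-∀
    ring₂ : ∀ D → (D ℤ.+ ℤ.+ 0) ℤ.- (ℤ.+ 0 ℤ.+ D) ≡ ℤ.+ 0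
    ring₂ = solveℤ-∀

  divφ+divφ² : ∀ c → divφ (ι c) ⊕ divφ (divφ (ι c)) ≡ ι c
  divφ+divφ² c = cong₂ _,_ (ring₁ c) (ring₂ c)
    where
    ring₁ : ∀ U → (ℤ.+ 0 ℤ.- U) ℤ.+ (U ℤ.- (ℤ.+ 0 ℤ.- U)) ≡ U
    ring₁ = solveℤ-∀
    ring₂ : ∀ U → U ℤ.+ (ℤ.+ 0 ℤ.- U) ≡ ℤ.+ 0
    ring₂ = solveℤ-∀

  -- Dividing u < d φ < u + 1 by φ and u < d′ φ² < u + 1 by φ², and adding (φ⁻¹ + φ⁻² = 1),
  -- gives u < d + d′ < u + 1.
  Floorφ-beatty : ∀ {d d′ u u′} → Floorφ d u → Floorφ d′ u′ → u ≢ u′ + d′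
  Floorφ-beatty {d} {d′} {u} {u′} (u<dφ , dφ<u+1) (u′<d′φ , d′φ<u′+1) refl =
    <-irrefl refl (<-≤-trans u<d+d′ (≤-pred d+d′<u+1))
    where
    u/φ<d : divφ (ι (+ u)) <φ ι (+ d)
    u/φ<d = subst (divφ (ι (+ u)) <φ_) (divφ-mulφ d) (divφ-mono-< u<dφ)
    u<d′φ² : ι (+ u) <φ mulφ d′ ⊕ ι (+ d′)
    u<d′φ² = subst (_<φ mulφ d′ ⊕ ι (+ d′)) (ι-+ u′ d′) (⊕-monoˡ-< (ι (+ d′)) u′<d′φ)
    u/φ²<d′ : divφ (divφ (ι (+ u))) <φ ι (+ d′)
    u/φ²<d′ = subst (divφ (divφ (ι (+ u))) <φ_) (divφ²-mulφ² d′) (divφ-mono-< (divφ-mono-< u<d′φ²))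
    u<d+d′ : u < d + d′
    u<d+d′ = ι+-cancel-< (subst₂ _<φ_ (divφ+divφ² (+ u)) (ι-+ d d′) (⊕-mono-< u/φ<d u/φ²<d′))
    d<[u+1]/φ : ι (+ d) <φ divφ (ι (+ suc u))
    d<[u+1]/φ = subst (_<φ divφ (ι (+ suc u))) (divφ-mulφ d) (divφ-mono-< dφ<u+1)
    d′φ²<u+1 : mulφ d′ ⊕ ι (+ d′) <φ ι (+ suc u)
    d′φ²<u+1 = subst (mulφ d′ ⊕ ι (+ d′) <φ_) (ι-+ (suc u′) d′) (⊕-monoˡ-< (ι (+ d′)) d′φ<u′+1)
    d′<[u+1]/φ² : ι (+ d′) <φ divφ (divφ (ι (+ suc u)))
    d′<[u+1]/φ² = subst (_<φ divφ (divφ (ι (+ suc u)))) (divφ²-mulφ² d′) (divφ-mono-< (divφ-mono-< d′φ²<u+1))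
    d+d′<u+1 : d + d′ < suc u
    d+d′<u+1 = ι+-cancel-< (subst₂ _<φ_ (ι-+ d d′) (divφ+divφ² (+ suc u)) (⊕-mono-< d<[u+1]/φ d′<[u+1]/φ²))

module FibonacciWords where

  open import Data.Nat as ℕ using (ℕ)
  import Data.Nat.Properties as ℕP
  open import Data.Integer as ℤ using (+_; -_; _+_; _-_; -[1+_])
  import Data.Integer.Properties as ℤP
  open import Data.Integer.Tactic.RingSolver using (solve-∀)
  open import Data.Product using (_,_; proj₁; proj₂; _×_)
  open import Data.Bool using (Bool; true; false)
  open import Data.List using (List; []; _∷_; foldl)
  open import Data.Unit using (⊤; tt)
  open import Relation.Binary.PropositionalEquality
  open GoldenOrder

  digit : Bool → ℕ
  digit true = 1
  digit false = 0

  -- (m , s) ↦ value of w d and of w d 0, where m and s are the values of w and w 0.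
  readDigit : ℕ × ℕ → Bool → ℕ × ℕ
  readDigit (m , s) d = (s ℕ.+ digit d , s ℕ.+ m ℕ.+ 2 ℕ.* digit d)

  values : List Bool → ℕ × ℕ
  values = foldl readDigit (0 , 0)

  value shiftedValue : List Bool → ℕ
  value w = proj₁ (values w)
  shiftedValue w = proj₂ (values w)

  -- ends00 also covers the words 0*.
  data Suffix : Set where
    ends00 ends1 ends10 has11 : Suffix

  suffixStep : Suffix → Bool → Suffix
  suffixStep has11 _ = has11
  suffixStep ends1 true = has11
  suffixStep ends1 false = ends10
  suffixStep _ true = ends1
  suffixStep _ false = ends00

  suffixOf : List Bool → Suffix
  suffixOf = foldl suffixStep ends00

  -- m φ - s; it lies in (1 - φ, 2 - φ) for words without 11, and then ⌊(m + 1) φ⌋ = s + 1.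
  defect : ℕ × ℕ → ℤ[φ]
  defect (m , s) = (- + s , + m)

  -- The open intervals, approximately: ends00 (-0.24, 0.15), ends1 (-0.62, -0.24), ends10 (0.15, 0.38).
  DefectBounds : Suffix → ℕ × ℕ → Set
  DefectBounds ends00 v = ((+ 3 , -[1+ 1 ]) <φ defect v) × (defect v <φ (+ 5 , -[1+ 2 ]))
  DefectBounds ends1 v = ((+ 1 , -[1+ 0 ]) <φ defect v) × (defect v <φ (+ 3 , -[1+ 1 ]))
  DefectBounds ends10 v = ((+ 5 , -[1+ 2 ]) <φ defect v) × (defect v <φ (+ 2 , -[1+ 0 ]))
  DefectBounds has11 v = ⊤

  φ⁻² : ℤ[φ]
  φ⁻² = (+ 2 , -[1+ 0 ])

  defect-read0 : ∀ v → defect (readDigit v false) ≡ ⊝ (divφ (defect v))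
  defect-read0 (m , s) = cong₂ _,_
    (trans (cong (λ z → - + z) (ℕP.+-identityʳ (s ℕ.+ m))) (trans (cong -_ (ℤP.pos-+ s m)) (ring (+ s) (+ m))))
    (trans (cong +_ (ℕP.+-identityʳ s)) (sym (ℤP.neg-involutive (+ s))))
    where
    ring : ∀ S M → - (S + M) ≡ - (M - - S)
    ring = solve-∀

  defect-read1 : ∀ v → defect (readDigit v true) ≡ ⊝ (divφ (defect v)) ⊖ φ⁻²
  defect-read1 (m , s) = cong₂ _,_
    (trans (cong -_ (trans (ℤP.pos-+ (s ℕ.+ m) 2) (cong (_+ + 2) (ℤP.pos-+ s m)))) (ring₁ (+ s) (+ m)))
    (trans (ℤP.pos-+ s 1) (ring₂ (+ s)))
    where
    ring₁ : ∀ S M → - (S + M + + 2) ≡ - (M - - S) + - + 2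
    ring₁ = solve-∀
    ring₂ : ∀ S → S + + 1 ≡ - - S + - -[1+ 0 ]
    ring₂ = solve-∀

  read0-mono : ∀ {a b x} → a <φ x → x <φ b →
               (⊝ (divφ b) <φ ⊝ (divφ x)) × (⊝ (divφ x) <φ ⊝ (divφ a))
  read0-mono a<x x<b = ⊝-anti-< (divφ-mono-< x<b) , ⊝-anti-< (divφ-mono-< a<x)

  read1-mono : ∀ {a b x} → a <φ x → x <φ b →
               (⊝ (divφ b) ⊖ φ⁻² <φ ⊝ (divφ x) ⊖ φ⁻²) × (⊝ (divφ x) ⊖ φ⁻² <φ ⊝ (divφ a) ⊖ φ⁻²)
  read1-mono a<x x<b with read0-mono a<x x<b
  ... | l , u = ⊕-monoˡ-< (⊝ φ⁻²) l , ⊕-monoˡ-< (⊝ φ⁻²) u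

  defectBounds-step : ∀ c v d → DefectBounds c v → DefectBounds (suffixStep c d) (readDigit v d)
  defectBounds-step ends00 v false (l , u) rewrite defect-read0 v with read0-mono l u
  ... | l′ , u′ = <φ-trans (<φ-byEvaluation (+ 3 , -[1+ 1 ]) (+ 8 , -[1+ 4 ]) 6) l′ , u′
  defectBounds-step ends00 v true (l , u) rewrite defect-read1 v with read1-mono l u
  ... | l′ , u′ = <φ-trans (<φ-byEvaluation (+ 1 , -[1+ 0 ]) (+ 6 , -[1+ 3 ]) 6) l′ , u′
  defectBounds-step ends1 v false (l , u) rewrite defect-read0 v = read0-mono l u
  defectBounds-step ends1 v true _ = tt
  defectBounds-step ends10 v false (l , u) rewrite defect-read0 v with read0-mono l u
  ... | l′ , u′ = l′ , <φ-trans u′ (<φ-byEvaluation (+ 8 , -[1+ 4 ]) (+ 5 , -[1+ 2 ]) 6)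
  defectBounds-step ends10 v true (l , u) rewrite defect-read1 v with read1-mono l u
  ... | l′ , u′ = l′ , <φ-trans u′ (<φ-byEvaluation (+ 6 , -[1+ 3 ]) (+ 3 , -[1+ 1 ]) 6)
  defectBounds-step has11 v d _ = tt

  defectBounds-foldl : ∀ w c v → DefectBounds c v → DefectBounds (foldl suffixStep c w) (foldl readDigit v w)
  defectBounds-foldl [] c v h = h
  defectBounds-foldl (d ∷ w) c v h = defectBounds-foldl w (suffixStep c d) (readDigit v d) (defectBounds-step c v d h)

  defectBounds : ∀ w → DefectBounds (suffixOf w) (values w)
  defectBounds w = defectBounds-foldl w ends00 (0 , 0) (<φ-byEvaluation _ _ 6 , <φ-byEvaluation _ _ 6)

module ZeckendorfRepresentation where

  open import Data.Nat using (ℕ; zero; suc; _+_; _*_; _∸_; _≤_; _<_; s≤s; z≤n; _⊓_; pred; _≤ᵇ_)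
  open import Data.Nat.Properties
  open import Data.Nat.Tactic.RingSolver using (solve-∀)
  open import Data.Product using (Σ; _,_; proj₁; proj₂; _×_)
  open import Data.Sum using (_⊎_; inj₁; inj₂)
  open import Data.Bool using (Bool; true; false; T)
  open import Data.List using (List; []; _∷_; foldl; length; _∷ʳ_; _++_; filter; upTo; [_])
  import Data.List.Properties as List
  open import Data.List.Reverse using (Reverse; reverseView; []; _∶_∶ʳ_)
  open import Data.Empty using (⊥-elim)
  open import Relation.Nullary using (yes; no)
  open import Data.Bool.Properties using (T-≡)
  open import Function.Bundles using (Equivalence)
  open import Relation.Binary.PropositionalEquality hiding ([_])
  open Fibonacci
  open FibonacciWords

  fibValue : List Bool → ℕ
  fibValue [] = 0
  fibValue (d ∷ w) = digit d * fib (length w) + fibValue w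

  length-∷ʳ : ∀ (w : List Bool) d → length (w ∷ʳ d) ≡ suc (length w)
  length-∷ʳ [] d = refl
  length-∷ʳ (x ∷ w) d = cong suc (length-∷ʳ w d)

  fibValue-∷ʳ : ∀ w d → fibValue (w ∷ʳ d) ≡ fibValue (w ∷ʳ false) + digit d
  fibValue-∷ʳ [] true = refl
  fibValue-∷ʳ [] false = refl
  fibValue-∷ʳ (x ∷ w) d rewrite length-∷ʳ w d | length-∷ʳ w false | fibValue-∷ʳ w d =
    sym (+-assoc (digit x * fib (suc (length w))) (fibValue (w ∷ʳ false)) (digit d))

  fibValue-∷ʳ-∷ʳ0 : ∀ w d →
                     fibValue (w ∷ʳ d ∷ʳ false) ≡ fibValue (w ∷ʳ false ∷ʳ false) + 2 * digit d
  fibValue-∷ʳ-∷ʳ0 [] true = refl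
  fibValue-∷ʳ-∷ʳ0 [] false = refl
  fibValue-∷ʳ-∷ʳ0 (x ∷ w) d
    rewrite length-∷ʳ (w ∷ʳ d) false | length-∷ʳ (w ∷ʳ false) false | length-∷ʳ w d | length-∷ʳ w false
          | fibValue-∷ʳ-∷ʳ0 w d =
    sym (+-assoc (digit x * fib (suc (suc (length w)))) (fibValue (w ∷ʳ false ∷ʳ false)) (2 * digit d))

  fibValue-∷ʳ0-rec : ∀ w → fibValue (w ∷ʳ false ∷ʳ false) ≡ fibValue (w ∷ʳ false) + fibValue w
  fibValue-∷ʳ0-rec [] = refl
  fibValue-∷ʳ0-rec (x ∷ w)
    rewrite length-∷ʳ (w ∷ʳ false) false | length-∷ʳ w false | fibValue-∷ʳ0-rec w =
    ring (digit x) (fib (suc (length w))) (fib (length w)) (fibValue (w ∷ʳ false)) (fibValue w)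
    where
    ring : ∀ a f₁ f₀ X Y → a * (f₁ + f₀) + (X + Y) ≡ (a * f₁ + X) + (a * f₀ + Y)
    ring = solve-∀

  values-∷ʳ : ∀ w d → values (w ∷ʳ d) ≡ readDigit (values w) d
  values-∷ʳ w d = List.foldl-∷ʳ readDigit (0 , 0) d w

  values≡fibValues : ∀ w → values w ≡ (fibValue w , fibValue (w ∷ʳ false))
  values≡fibValues w = go w (reverseView w)
    where
    go : ∀ w → Reverse w → values w ≡ (fibValue w , fibValue (w ∷ʳ false))
    go .[] [] = refl
    go .(w ∷ʳ d) (w ∶ rw ∶ʳ d) rewrite values-∷ʳ w d | go w rw =
      cong₂ _,_ (sym (fibValue-∷ʳ w d))
                (sym (trans (fibValue-∷ʳ-∷ʳ0 w d) (cong (_+ 2 * digit d) (fibValue-∷ʳ0-rec w))))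

  value≡fibValue : ∀ w → value w ≡ fibValue w
  value≡fibValue w = cong proj₁ (values≡fibValues w)

  length-filter-fib≤ : ∀ n K → (∀ k → fib k ≤ n → k < K) → (∀ k → k < K → fib k ≤ n) →
                       ∀ N → length (filter (λ k → fib k ≤? n) (upTo N)) ≡ N ⊓ K
  length-filter-fib≤ n K small⇒<K <K⇒small zero = refl
  length-filter-fib≤ n K small⇒<K <K⇒small (suc N) = begin
    length (filter P? (upTo (suc N)))                  ≡⟨ cong (λ l → length (filter P? l)) (sym (List.upTo-∷ʳ N)) ⟩
    length (filter P? (upTo N ++ [ N ]))               ≡⟨ cong length (List.filter-++ P? (upTo N) [ N ]) ⟩
    length (filter P? (upTo N) ++ filter P? [ N ])     ≡⟨ List.length-++ (filter P? (upTo N)) ⟩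
    length (filter P? (upTo N)) + length (filter P? [ N ])
      ≡⟨ cong (_+ length (filter P? [ N ])) (length-filter-fib≤ n K small⇒<K <K⇒small N) ⟩
    N ⊓ K + length (filter P? [ N ])                   ≡⟨ last ⟩
    suc N ⊓ K                                          ∎
    where
    open ≡-Reasoning
    P? = λ k → fib k ≤? n
    last : N ⊓ K + length (filter P? [ N ]) ≡ suc N ⊓ K
    last with N <? K
    ... | yes N<K rewrite List.filter-accept P? {N} {[]} (<K⇒small N N<K)
                        | m≤n⇒m⊓n≡m (<⇒≤ N<K) | m≤n⇒m⊓n≡m N<K =
      +-comm N 1
    ... | no N≮K rewrite List.filter-reject P? {N} {[]} (λ small → N≮K (small⇒<K N small))
                       | m≥n⇒m⊓n≡n (≮⇒≥ N≮K) | m≥n⇒m⊓n≡n (≤-trans (≮⇒≥ N≮K) (n≤1+n N)) =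
      +-identityʳ K

  -- K is the length of rep_F n.
  IsRepLength : ℕ → ℕ → Set
  IsRepLength n K = ((K ≡ 0) ⊎ (fib (pred K) ≤ n)) × (n < fib K)

  repLength-unique : ∀ n K → IsRepLength n K → repLength n ≡ K
  repLength-unique n K (top , n<F) =
    trans (length-filter-fib≤ n K small⇒<K (<K⇒small top) (suc n)) (m≥n⇒m⊓n≡n (K≤n+1 top))
    where
    small⇒<K : ∀ k → fib k ≤ n → k < K
    small⇒<K k Fk≤n with k <? K
    ... | yes k<K = k<K
    ... | no k≮K = ⊥-elim (<-irrefl refl (<-≤-trans n<F (≤-trans (fib-mono-≤ (≮⇒≥ k≮K)) Fk≤n)))
    <K⇒small : ∀ {K} → (K ≡ 0) ⊎ (fib (pred K) ≤ n) → ∀ k → k < K → fib k ≤ n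
    <K⇒small (inj₁ refl) k ()
    <K⇒small {suc K′} (inj₂ F≤n) k (s≤s k≤K′) = ≤-trans (fib-mono-≤ k≤K′) F≤n
    K≤n+1 : ∀ {K} → (K ≡ 0) ⊎ (fib (pred K) ≤ n) → K ≤ suc n
    K≤n+1 {zero} _ = z≤n
    K≤n+1 {suc K′} (inj₂ F≤n) = ≤-trans (<-≤-trans (n<fib K′) F≤n) (n≤1+n n)

  repLength-exists : ∀ n → Σ ℕ (IsRepLength n)
  repLength-exists zero = 0 , inj₁ refl , s≤s z≤n
  repLength-exists (suc n) with repLength-exists n
  ... | K , top , n<F with suc n <? fib K
  ...   | yes n+1<F = K , weaken top , n+1<F
    where
    weaken : (K ≡ 0) ⊎ (fib (pred K) ≤ n) → (K ≡ 0) ⊎ (fib (pred K) ≤ suc n)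
    weaken (inj₁ K≡0) = inj₁ K≡0
    weaken (inj₂ F≤n) = inj₂ (≤-trans F≤n (n≤1+n n))
  ...   | no n+1≮F = suc K , inj₂ (≮⇒≥ n+1≮F) , subst (_< fib (suc K)) (sym n+1≡F) (fib-<-suc K)
    where
    n+1≡F : suc n ≡ fib K
    n+1≡F = ≤-antisym n<F (≮⇒≥ n+1≮F)


  length-greedyDigits : ∀ k r → length (greedyDigits k r) ≡ k
  length-greedyDigits zero r = refl
  length-greedyDigits (suc k) r with fib k ≤ᵇ r
  ... | true = cong suc (length-greedyDigits k _)
  ... | false = cong suc (length-greedyDigits k _)

  fib-pred-≤ : ∀ k → fib (pred k) ≤ fib k
  fib-pred-≤ k = fib-mono-≤ (pred[n]≤n {k})

  greedy-remainder : ∀ k r → r < fib (suc k) → fib k ≤ r → r ∸ fib k < fib (pred k)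
  greedy-remainder k r r<F F≤r =
    +-cancelˡ-< (fib k) _ _ (subst₂ _<_ (sym (m+[n∸m]≡n F≤r)) (sym (fib+fib-pred k)) r<F)

  fibValue-greedyDigits : ∀ k r → r < fib k → fibValue (greedyDigits k r) ≡ r
  fibValue-greedyDigits zero zero _ = refl
  fibValue-greedyDigits zero (suc r) (s≤s ())
  fibValue-greedyDigits (suc k) r r<F with fib k ≤ᵇ r in eq
  ... | true = trans (cong₂ _+_ (trans (*-identityˡ _) (cong fib (length-greedyDigits k _)))
                                 (fibValue-greedyDigits k (r ∸ fib k) r∸F<F))
                     (m+[n∸m]≡n F≤r)
    where
    F≤r : fib k ≤ r
    F≤r = ≤ᵇ⇒≤ (fib k) r (Equivalence.from T-≡ eq)
    r∸F<F : r ∸ fib k < fib k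
    r∸F<F = <-≤-trans (greedy-remainder k r r<F F≤r) (fib-pred-≤ k)
  ... | false = fibValue-greedyDigits k r (≰⇒> λ F≤r → subst T eq (≤⇒≤ᵇ F≤r))

  greedyDigits-admissible : ∀ k r c → r < fib k → c ≢ has11 → (c ≡ ends1 → r < fib (pred k)) →
                            foldl suffixStep c (greedyDigits k r) ≢ has11
  greedyDigits-admissible zero r c _ c≢11 _ = c≢11
  greedyDigits-admissible (suc k) r c r<F c≢11 ends1⇒ with fib k ≤ᵇ r in eq
  ... | true = after1 c c≢11 ends1⇒
    where
    F≤r : fib k ≤ r
    F≤r = ≤ᵇ⇒≤ (fib k) r (Equivalence.from T-≡ eq)
    rest : foldl suffixStep ends1 (greedyDigits k (r ∸ fib k)) ≢ has11
    rest = greedyDigits-admissible k (r ∸ fib k) ends1 (<-≤-trans (greedy-remainder k r r<F F≤r) (fib-pred-≤ k))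
             (λ ()) (λ _ → greedy-remainder k r r<F F≤r)
    after1 : ∀ c → c ≢ has11 → (c ≡ ends1 → r < fib k) →
             foldl suffixStep (suffixStep c true) (greedyDigits k (r ∸ fib k)) ≢ has11
    after1 ends00 _ _ = rest
    after1 ends10 _ _ = rest
    after1 ends1 _ r<F′ = ⊥-elim (<-irrefl refl (<-≤-trans (r<F′ refl) F≤r))
    after1 has11 c≢11 _ = ⊥-elim (c≢11 refl)
  ... | false = after0 c c≢11
    where
    r<F′ : r < fib k
    r<F′ = ≰⇒> λ F≤r → subst T eq (≤⇒≤ᵇ F≤r)
    after0 : ∀ c → c ≢ has11 → foldl suffixStep (suffixStep c false) (greedyDigits k r) ≢ has11
    after0 ends00 _ = greedyDigits-admissible k r ends00 r<F′ (λ ()) (λ ())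
    after0 ends1 _ = greedyDigits-admissible k r ends10 r<F′ (λ ()) (λ ())
    after0 ends10 _ = greedyDigits-admissible k r ends00 r<F′ (λ ()) (λ ())
    after0 has11 c≢11 = ⊥-elim (c≢11 refl)

  repF≡greedyDigits : ∀ n → repF n ≡ greedyDigits (proj₁ (repLength-exists n)) n
  repF≡greedyDigits n = cong (λ K → greedyDigits K n) (repLength-unique n _ (proj₂ (repLength-exists n)))

  value-repF : ∀ n → value (repF n) ≡ n
  value-repF n rewrite repF≡greedyDigits n with repLength-exists n
  ... | K , _ , n<F = trans (value≡fibValue (greedyDigits K n)) (fibValue-greedyDigits K n n<F)

  repF-admissible : ∀ n → suffixOf (repF n) ≢ has11
  repF-admissible n rewrite repF≡greedyDigits n with repLength-exists n
  ... | K , _ , n<F = greedyDigits-admissible K n ends00 n<F (λ ()) (λ ())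

  has11-absorbing : ∀ w → foldl suffixStep has11 w ≡ has11
  has11-absorbing [] = refl
  has11-absorbing (d ∷ w) = has11-absorbing w

  fibValue-1∷ : ∀ w → fibValue w < fib (pred (length w)) → fibValue (true ∷ w) < fib (suc (length w))
  fibValue-1∷ w small =
    subst₂ _<_ (cong (_+ fibValue w) (sym (*-identityˡ (fib (length w))))) (fib+fib-pred (length w))
                          (+-monoʳ-< (fib (length w)) small)

  fib≤fibValue-1∷ : ∀ w → fib (length w) ≤ fibValue (true ∷ w)
  fib≤fibValue-1∷ w =
    subst (fib (length w) ≤_) (cong (_+ fibValue w) (sym (*-identityˡ (fib (length w))))) (m≤m+n _ _)

  fibValue-admissible : ∀ w c → foldl suffixStep c w ≢ has11 →
                        (fibValue w < fib (length w)) × (c ≡ ends1 → fibValue w < fib (pred (length w)))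
  fibValue-admissible [] c _ = s≤s z≤n , λ _ → s≤s z≤n
  fibValue-admissible (true ∷ w) ends00 ok = fibValue-1∷ w (proj₂ (fibValue-admissible w ends1 ok) refl) , λ ()
  fibValue-admissible (true ∷ w) ends10 ok = fibValue-1∷ w (proj₂ (fibValue-admissible w ends1 ok) refl) , λ ()
  fibValue-admissible (true ∷ w) ends1 ok = ⊥-elim (ok (has11-absorbing w))
  fibValue-admissible (true ∷ w) has11 ok = ⊥-elim (ok (has11-absorbing w))
  fibValue-admissible (false ∷ w) ends00 ok = <-trans small (fib-<-suc (length w)) , λ ()
    where small = proj₁ (fibValue-admissible w ends00 ok)
  fibValue-admissible (false ∷ w) ends1 ok = <-trans small (fib-<-suc (length w)) , λ _ → small
    where small = proj₁ (fibValue-admissible w ends10 ok)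
  fibValue-admissible (false ∷ w) ends10 ok = <-trans small (fib-<-suc (length w)) , λ ()
    where small = proj₁ (fibValue-admissible w ends00 ok)
  fibValue-admissible (false ∷ w) has11 ok = ⊥-elim (ok (has11-absorbing w))

  greedyDigits-fibValue : ∀ w c → foldl suffixStep c w ≢ has11 → greedyDigits (length w) (fibValue w) ≡ w
  greedyDigits-fibValue [] c _ = refl
  greedyDigits-fibValue (true ∷ w) c ok = after c ok
    where
    L = length w
    v∸F : fibValue (true ∷ w) ∸ fib L ≡ fibValue w
    v∸F = trans (cong (λ z → z + fibValue w ∸ fib L) (*-identityˡ (fib L))) (m+n∸m≡n (fib L) (fibValue w))
    take1 : foldl suffixStep ends1 w ≢ has11 → greedyDigits (suc L) (fibValue (true ∷ w)) ≡ true ∷ w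
    take1 ok′ with fib L ≤ᵇ fibValue (true ∷ w) in eq
    ... | true = cong (true ∷_) (trans (cong (greedyDigits L) v∸F) (greedyDigits-fibValue w ends1 ok′))
    ... | false = ⊥-elim (subst T eq (≤⇒≤ᵇ (fib≤fibValue-1∷ w)))
    after : ∀ c → foldl suffixStep c (true ∷ w) ≢ has11 →
            greedyDigits (suc L) (fibValue (true ∷ w)) ≡ true ∷ w
    after ends00 ok = take1 ok
    after ends10 ok = take1 ok
    after ends1 ok = ⊥-elim (ok (has11-absorbing w))
    after has11 ok = ⊥-elim (ok (has11-absorbing w))
  greedyDigits-fibValue (false ∷ w) c ok = after c ok
    where
    L = length w
    skip : ∀ c′ → foldl suffixStep c′ w ≢ has11 → greedyDigits (suc L) (fibValue (false ∷ w)) ≡ false ∷ w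
    skip c′ ok′ with fib L ≤ᵇ fibValue (false ∷ w) in eq
    ... | true = ⊥-elim (<-irrefl refl (<-≤-trans (proj₁ (fibValue-admissible w c′ ok′))
                                                    (≤ᵇ⇒≤ (fib L) (fibValue w) (Equivalence.from T-≡ eq))))
    ... | false = cong (false ∷_) (greedyDigits-fibValue w c′ ok′)
    after : ∀ c → foldl suffixStep c (false ∷ w) ≢ has11 →
            greedyDigits (suc L) (fibValue (false ∷ w)) ≡ false ∷ w
    after ends00 ok = skip ends00 ok
    after ends1 ok = skip ends10 ok
    after ends10 ok = skip ends00 ok
    after has11 ok = ⊥-elim (ok (has11-absorbing w))

  repF-value : ∀ w → suffixOf (true ∷ w) ≢ has11 → repF (value (true ∷ w)) ≡ true ∷ w
  repF-value w ok rewrite value≡fibValue (true ∷ w) =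
    trans (cong (λ K → greedyDigits K (fibValue (true ∷ w)))
                (repLength-unique _ (suc (length w))
                                  (inj₂ (fib≤fibValue-1∷ w) , proj₁ (fibValue-admissible (true ∷ w) ends00 ok))))
          (greedyDigits-fibValue (true ∷ w) ends00 ok)

module FloorSequence where

  open import Data.Nat using (ℕ; zero; suc; _+_; _*_; _≤_; _<_; s≤s; z≤n)
  open import Data.Nat.Properties
  open import Data.Nat.Tactic.RingSolver using (solve-∀)
  open import Data.Integer as ℤ using (+_; -_; -[1+_])
  import Data.Integer.Properties as ℤP
  open import Data.Integer.Tactic.RingSolver using () renaming (solve-∀ to solveℤ-∀)
  open import Data.Product using (Σ; _,_; proj₁; _×_)
  open import Data.Sum using (_⊎_; inj₁; inj₂)
  open import Data.Bool using (true; false)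
  open import Data.List using (List; []; _∷_; _∷ʳ_)
  import Data.List.Properties as List
  open import Data.List.Reverse using (Reverse; reverseView; []; _∶_∶ʳ_)
  open import Data.Empty using (⊥-elim)
  open import Relation.Binary.PropositionalEquality
  open StrictMonotonicity
  open GoldenOrder
  open FloorsOfMultiples
  open FibonacciWords
  open ZeckendorfRepresentation

  defect-lower⇒ : ∀ m s a b → (+ a , - + b) <φ defect (m , s) → ι (+ (s + a)) <φ mulφ (m + b)
  defect-lower⇒ m s a b (mk<φ h) = mk<φ (positive-resp
    (cong₂ _,_ (trans (ring₁ (+ s) (+ a)) (cong (λ z → ℤ.+ 0 ℤ.+ ℤ.- z) (sym (ℤP.pos-+ s a))))
               (trans (ring₂ (+ m) (+ b)) (cong (λ z → z ℤ.+ ℤ.- ℤ.+ 0) (sym (ℤP.pos-+ m b))))) h)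
    where
    ring₁ : ∀ S A → ℤ.- S ℤ.+ ℤ.- A ≡ ℤ.+ 0 ℤ.+ ℤ.- (S ℤ.+ A)
    ring₁ = solveℤ-∀
    ring₂ : ∀ M B → M ℤ.+ ℤ.- (ℤ.- B) ≡ (M ℤ.+ B) ℤ.+ ℤ.- ℤ.+ 0
    ring₂ = solveℤ-∀

  defect-upper⇒ : ∀ m s a b → defect (m , s) <φ (+ a , - + b) → mulφ (m + b) <φ ι (+ (s + a))
  defect-upper⇒ m s a b (mk<φ h) = mk<φ (positive-resp
    (cong₂ _,_ (trans (ring₁ (+ s) (+ a)) (cong (λ z → z ℤ.+ ℤ.- ℤ.+ 0) (sym (ℤP.pos-+ s a))))
               (trans (ring₂ (+ m) (+ b)) (cong (λ z → ℤ.+ 0 ℤ.+ ℤ.- z) (sym (ℤP.pos-+ m b))))) h)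
    where
    ring₁ : ∀ S A → A ℤ.+ ℤ.- (ℤ.- S) ≡ (S ℤ.+ A) ℤ.+ ℤ.- ℤ.+ 0
    ring₁ = solveℤ-∀
    ring₂ : ∀ M B → ℤ.- B ℤ.+ ℤ.- M ≡ ℤ.+ 0 ℤ.+ ℤ.- (M ℤ.+ B)
    ring₂ = solveℤ-∀

  defect-admissible : ∀ c v → DefectBounds c v → c ≢ has11 →
                      ((+ 1 , - + 1) <φ defect v) × (defect v <φ (+ 2 , - + 1))
  defect-admissible ends00 v (l , u) _ =
    <φ-trans (<φ-byEvaluation (+ 1 , - + 1) (+ 3 , -[1+ 1 ]) 6) l ,
    <φ-trans u (<φ-byEvaluation (+ 5 , -[1+ 2 ]) (+ 2 , - + 1) 6)
  defect-admissible ends1 v (l , u) _ = l , <φ-trans u (<φ-byEvaluation (+ 3 , -[1+ 1 ]) (+ 2 , - + 1) 6)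
  defect-admissible ends10 v (l , u) _ = <φ-trans (<φ-byEvaluation (+ 1 , - + 1) (+ 5 , -[1+ 2 ]) 6) l , u
  defect-admissible has11 v _ ok = ⊥-elim (ok refl)

  Floorφ-value+1 : ∀ w → suffixOf w ≢ has11 → Floorφ (value w + 1) (shiftedValue w + 1)
  Floorφ-value+1 w ok with defect-admissible (suffixOf w) (values w) (defectBounds w) ok
  ... | l , u = defect-lower⇒ (value w) (shiftedValue w) 1 1 l ,
                subst (λ z → mulφ (value w + 1) <φ ι (+ z)) (+-suc (shiftedValue w) 1)
                      (defect-upper⇒ (value w) (shiftedValue w) 2 1 u)

  isEnds10 : Suffix → ℕ
  isEnds10 ends10 = 1
  isEnds10 _ = 0

  Floorφ-value+3 : ∀ w → suffixOf w ≢ has11 →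
                   Floorφ (value w + 3) (shiftedValue w + 4 + isEnds10 (suffixOf w))
  Floorφ-value+3 w ok = go (suffixOf w) (defectBounds w) ok
    where
    m = value w
    s = shiftedValue w
    s+5 : s + 5 ≡ suc (s + 4 + 0)
    s+5 = trans (+-suc s 4) (cong suc (sym (+-identityʳ (s + 4))))
    go : ∀ c → DefectBounds c (values w) → c ≢ has11 → Floorφ (m + 3) (s + 4 + isEnds10 c)
    go ends00 (l , u) _ =
      subst (λ z → ι (+ z) <φ mulφ (m + 3)) (sym (+-identityʳ (s + 4)))
        (defect-lower⇒ m s 4 3 (<φ-trans (<φ-byEvaluation (+ 4 , - + 3) (+ 3 , -[1+ 1 ]) 6) l)) ,
      subst (λ z → mulφ (m + 3) <φ ι (+ z)) s+5 (defect-upper⇒ m s 5 3 u)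
    go ends1 (l , u) _ =
      subst (λ z → ι (+ z) <φ mulφ (m + 3)) (sym (+-identityʳ (s + 4)))
        (defect-lower⇒ m s 4 3 (<φ-trans (<φ-byEvaluation (+ 4 , - + 3) (+ 1 , -[1+ 0 ]) 6) l)) ,
      subst (λ z → mulφ (m + 3) <φ ι (+ z)) s+5
        (defect-upper⇒ m s 5 3 (<φ-trans u (<φ-byEvaluation (+ 3 , -[1+ 1 ]) (+ 5 , - + 3) 6)))
    go ends10 (l , u) _ =
      subst (λ z → ι (+ z) <φ mulφ (m + 3)) s+5′ (defect-lower⇒ m s 5 3 l) ,
      subst (λ z → mulφ (m + 3) <φ ι (+ z)) (trans (+-suc s 5) (cong suc s+5′))
        (defect-upper⇒ m s 6 3 (<φ-trans u (<φ-byEvaluation (+ 2 , -[1+ 0 ]) (+ 6 , - + 3) 6)))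
      where
      s+5′ : s + 5 ≡ s + 4 + 1
      s+5′ = trans (+-suc s 4) (sym (+-comm (s + 4) 1))
    go has11 _ ok = ⊥-elim (ok refl)

  floorφ : ℕ → ℕ
  floorφ zero = 0
  floorφ (suc n) = shiftedValue (repF n) + 1

  floorφ² : ℕ → ℕ
  floorφ² d = floorφ d + d

  Floorφ-floorφ : ∀ n → Floorφ (suc n) (floorφ (suc n))
  Floorφ-floorφ n = subst (λ k → Floorφ k (floorφ (suc n))) (trans (cong (_+ 1) (value-repF n)) (+-comm n 1))
                      (Floorφ-value+1 (repF n) (repF-admissible n))

  floorφ-unique : ∀ {k u} → 1 ≤ k → Floorφ k u → floorφ k ≡ u
  floorφ-unique {suc n} _ = Floorφ-unique (Floorφ-floorφ n)

  floorφ-+3 : ∀ m → floorφ (m + 3) ≡ floorφ (m + 1) + 3 + isEnds10 (suffixOf (repF m))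
  floorφ-+3 m = floorφ-unique (subst (1 ≤_) (+-comm 3 m) (s≤s z≤n))
    (subst₂ Floorφ (cong (_+ 3) (value-repF m)) (rearrange (isEnds10 (suffixOf (repF m))))
      (Floorφ-value+3 (repF m) (repF-admissible m)))
    where
    rearrange : ∀ t → shiftedValue (repF m) + 4 + t ≡ floorφ (m + 1) + 3 + t
    rearrange t rewrite +-comm m 1 = cong (_+ t) (sym (+-assoc (shiftedValue (repF m)) 1 3))

  floorφ-suc : ∀ n → (floorφ (suc n) < floorφ (suc (suc n))) × (floorφ (suc (suc n)) ≤ floorφ (suc n) + 2)
  floorφ-suc n = Floorφ-suc (Floorφ-floorφ n) (Floorφ-floorφ (suc n))

  floorφ≢floorφ² : ∀ {d d′} → 1 ≤ d → 1 ≤ d′ → floorφ d ≢ floorφ² d′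
  floorφ≢floorφ² {suc d} {suc d′} _ _ = Floorφ-beatty (Floorφ-floorφ d) (Floorφ-floorφ d′)

  shiftedValue-repF : ∀ w → suffixOf w ≢ has11 → shiftedValue (repF (value w)) ≡ shiftedValue w
  shiftedValue-repF w ok = +-cancelʳ-≡ 1 _ _
    (Floorφ-unique (subst (λ k → Floorφ k (shiftedValue (repF (value w)) + 1)) (cong (_+ 1) (value-repF (value w)))
                     (Floorφ-value+1 (repF (value w)) (repF-admissible (value w))))
                   (Floorφ-value+1 w ok))

  suffixOf-∷ʳ : ∀ w d → suffixOf (w ∷ʳ d) ≡ suffixStep (suffixOf w) d
  suffixOf-∷ʳ w d = List.foldl-∷ʳ suffixStep ends00 d w

  admissible-∷ʳ⁻ : ∀ w d → suffixOf (w ∷ʳ d) ≢ has11 → suffixOf w ≢ has11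
  admissible-∷ʳ⁻ w d ok w11 = ok (trans (suffixOf-∷ʳ w d) (cong (λ c → suffixStep c d) w11))

  suffixStep-11 : ∀ c → suffixStep (suffixStep c true) true ≡ has11
  suffixStep-11 ends00 = refl
  suffixStep-11 ends1 = refl
  suffixStep-11 ends10 = refl
  suffixStep-11 has11 = refl

  BeattyValue : ℕ → Set
  BeattyValue k = Σ ℕ λ d → (k ≡ floorφ (suc d)) ⊎ (k ≡ floorφ² (suc d))

  -- With d = value w: value (w 0) + 1 = ⌊(d + 1) φ⌋ and value (w 0 1) + 1 = ⌊(d + 1) φ²⌋.
  BeattyValue-∷ʳ0 : ∀ w → suffixOf (w ∷ʳ false) ≢ has11 → BeattyValue (suc (value (w ∷ʳ false)))
  BeattyValue-∷ʳ0 w ok rewrite values-∷ʳ w false =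
    value w ,
    inj₁ (trans (ring (shiftedValue w)) (cong (_+ 1) (sym (shiftedValue-repF w (admissible-∷ʳ⁻ w false ok)))))
    where
    ring : ∀ s → suc (s + 0) ≡ s + 1
    ring = solve-∀

  BeattyValue-∷ʳ01 : ∀ w → suffixOf (w ∷ʳ false ∷ʳ true) ≢ has11 →
                          BeattyValue (suc (value (w ∷ʳ false ∷ʳ true)))
  BeattyValue-∷ʳ01 w ok rewrite values-∷ʳ (w ∷ʳ false) true | values-∷ʳ w false =
    value w ,
    inj₂ (trans (ring (shiftedValue w) (value w)) (cong (λ z → z + 1 + suc (value w)) (sym (shiftedValue-repF w w-ok))))
    where
    ring : ∀ s m → suc (s + m + 2 * 0 + 1) ≡ s + 1 + suc m
    ring = solve-∀
    w-ok : suffixOf w ≢ has11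
    w-ok = admissible-∷ʳ⁻ w false (admissible-∷ʳ⁻ (w ∷ʳ false) true ok)

  BeattyValue-∷ʳ1 : ∀ w → Reverse w → suffixOf (w ∷ʳ true) ≢ has11 →
                         BeattyValue (suc (value (w ∷ʳ true)))
  BeattyValue-∷ʳ1 .[] [] _ = 0 , inj₂ refl
  BeattyValue-∷ʳ1 .(w ∷ʳ false) (w ∶ _ ∶ʳ false) ok = BeattyValue-∷ʳ01 w ok
  BeattyValue-∷ʳ1 .(w ∷ʳ true) (w ∶ _ ∶ʳ true) ok =
    ⊥-elim (ok (trans (suffixOf-∷ʳ (w ∷ʳ true) true)
                      (trans (cong (λ c → suffixStep c true) (suffixOf-∷ʳ w true)) (suffixStep-11 (suffixOf w)))))

  BeattyValue-value+1 : ∀ w → Reverse w → suffixOf w ≢ has11 → BeattyValue (suc (value w))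
  BeattyValue-value+1 .[] [] _ = 0 , inj₁ refl
  BeattyValue-value+1 .(w ∷ʳ false) (w ∶ _ ∶ʳ false) ok = BeattyValue-∷ʳ0 w ok
  BeattyValue-value+1 .(w ∷ʳ true) (w ∶ rw ∶ʳ true) ok = BeattyValue-∷ʳ1 w rw ok

  beatty-cover : ∀ n → BeattyValue (suc n)
  beatty-cover n =
    subst (λ m → BeattyValue (suc m)) (value-repF n)
          (BeattyValue-value+1 (repF n) (reverseView (repF n)) (repF-admissible n))

  floorφ-mono-< : ∀ {d d′} → 1 ≤ d → d < d′ → floorφ d < floorφ d′
  floorφ-mono-< {suc d} {suc d′} _ (s≤s d<d′) =
    mono-suc⇒mono (λ n → floorφ (suc n)) (λ n → proj₁ (floorφ-suc n)) d<d′

  floorφ-injective : ∀ {d d′} → 1 ≤ d → 1 ≤ d′ → floorφ d ≡ floorφ d′ → d ≡ d′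
  floorφ-injective {suc d} {suc d′} _ _ eq =
    cong suc (mono⇒injective (λ n → floorφ (suc n)) (mono-suc⇒mono _ (λ n → proj₁ (floorφ-suc n))) eq)

  floorφ²-mono-< : ∀ {d d′} → 1 ≤ d → d < d′ → floorφ² d < floorφ² d′
  floorφ²-mono-< 1≤d d<d′ = +-mono-< (floorφ-mono-< 1≤d d<d′) d<d′

  floorφ²-injective : ∀ {d d′} → 1 ≤ d → 1 ≤ d′ → floorφ² d ≡ floorφ² d′ → d ≡ d′
  floorφ²-injective {suc d} {suc d′} _ _ eq =
    cong suc (mono⇒injective (λ n → floorφ² (suc n)) (λ n<n′ → floorφ²-mono-< (s≤s z≤n) (s≤s n<n′)) eq)

  floorφ²-mono-≤ : ∀ {d d′} → 1 ≤ d → d ≤ d′ → floorφ² d ≤ floorφ² d′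
  floorφ²-mono-≤ 1≤d d≤d′ with m≤n⇒m<n∨m≡n d≤d′
  ... | inj₁ d<d′ = <⇒≤ (floorφ²-mono-< 1≤d d<d′)
  ... | inj₂ refl = ≤-refl

  floorφ-spec : ∀ {k} → 1 ≤ k → Floorφ k (floorφ k)
  floorφ-spec {suc n} _ = Floorφ-floorφ n

module Lucas where

  open import Data.Nat using (ℕ; zero; suc; _+_; _∸_; _≤_; _<_; s≤s; z≤n)
  open import Data.Nat.Properties
  open import Data.Integer as ℤ using (+_; -_)
  import Data.Integer.Properties as ℤP
  open import Data.Integer.Tactic.RingSolver using () renaming (solve-∀ to solveℤ-∀)
  open import Data.Product using (Σ; _,_; proj₁; proj₂; _×_)
  open import Data.Sum using (inj₁; inj₂)
  open import Relation.Binary.Definitions using (tri<; tri≈; tri>)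
  open import Relation.Binary.PropositionalEquality
  open StrictMonotonicity
  open GoldenOrder
  open FloorsOfMultiples
  open FibonacciWords
  open FloorSequence

  lucas : ℕ → ℕ
  lucas zero = 2
  lucas (suc zero) = 1
  lucas (suc (suc j)) = lucas (suc j) + lucas j

  oddIdx evenIdx : ℕ → ℕ
  oddIdx zero = 3
  oddIdx (suc t) = suc (suc (oddIdx t))
  evenIdx t = suc (oddIdx t)

  lucas>0 : ∀ j → 0 < lucas j
  lucas>0 zero = s≤s z≤n
  lucas>0 (suc zero) = s≤s z≤n
  lucas>0 (suc (suc j)) = ≤-trans (lucas>0 (suc j)) (m≤m+n _ _)

  -- L j φ - L (j + 1) = √5 (-φ)⁻ʲ: small, of alternating sign.
  lucasDefect : ℕ → ℤ[φ]
  lucasDefect j = defect (lucas j , lucas (suc j))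

  lucasDefect-suc : ∀ j → ⊝ (divφ (lucasDefect j)) ≡ lucasDefect (suc j)
  lucasDefect-suc j =
    cong₂ _,_ (trans (ring (+ lucas (suc j)) (+ lucas j)) (cong ℤ.-_ (sym (ℤP.pos-+ (lucas (suc j)) (lucas j)))))
              (ℤP.neg-involutive (+ lucas (suc j)))
    where
    ring : ∀ P Q → ℤ.- (Q ℤ.- ℤ.- P) ≡ ℤ.- (P ℤ.+ Q)
    ring = solveℤ-∀

  lucasDefect-odd : ∀ t → ((+ 1 , - + 1) <φ lucasDefect (oddIdx t)) × (lucasDefect (oddIdx t) <φ ι (+ 0))
  lucasDefect-even : ∀ t → (ι (+ 0) <φ lucasDefect (evenIdx t)) × (lucasDefect (evenIdx t) <φ (- + 1 , + 1))
  lucasDefect-odd zero = <φ-byEvaluation _ _ 6 , <φ-byEvaluation _ _ 6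
  lucasDefect-odd (suc t) with read0-mono (proj₁ (lucasDefect-even t)) (proj₂ (lucasDefect-even t))
  ... | l , u rewrite lucasDefect-suc (evenIdx t) = <φ-trans (<φ-byEvaluation (+ 1 , - + 1) (- + 2 , + 1) 6) l , u
  lucasDefect-even t with read0-mono (proj₁ (lucasDefect-odd t)) (proj₂ (lucasDefect-odd t))
  ... | l , u rewrite lucasDefect-suc (oddIdx t) = l , <φ-trans u (<φ-byEvaluation (+ 2 , - + 1) (- + 1 , + 1) 6)

  ι<defect⇒ : ∀ m s c → ι c <φ defect (m , s) → ι (c ℤ.+ + s) <φ mulφ m
  ι<defect⇒ m s c (mk<φ h) = mk<φ (positive-resp (cong₂ _,_ (ring (+ s) c) refl) h)
    where
    ring : ∀ S C → ℤ.- S ℤ.+ ℤ.- C ≡ ℤ.+ 0 ℤ.+ ℤ.- (C ℤ.+ S)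
    ring = solveℤ-∀

  defect<ι⇒ : ∀ m s c → defect (m , s) <φ ι c → mulφ m <φ ι (c ℤ.+ + s)
  defect<ι⇒ m s c (mk<φ h) = mk<φ (positive-resp (cong₂ _,_ (ring (+ s) c) refl) h)
    where
    ring : ∀ S C → C ℤ.+ ℤ.- (ℤ.- S) ≡ (C ℤ.+ S) ℤ.+ ℤ.- ℤ.+ 0
    ring = solveℤ-∀

  Floorφ-from-defect : ∀ k s u c → c ℤ.+ + s ≡ + u →
                       ι c <φ defect (k , s) → defect (k , s) <φ ι (c ℤ.+ + 1) → Floorφ k u
  Floorφ-from-defect k s u c c+s≡u lower upper =
    subst (λ z → ι z <φ mulφ k) c+s≡u (ι<defect⇒ k s c lower) ,
    subst (λ z → mulφ k <φ ι z) c+1+s≡u+1 (defect<ι⇒ k s (c ℤ.+ + 1) upper)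
    where
    ring : ∀ C S → C ℤ.+ + 1 ℤ.+ S ≡ + 1 ℤ.+ (C ℤ.+ S)
    ring = solveℤ-∀
    c+1+s≡u+1 : c ℤ.+ + 1 ℤ.+ + s ≡ + suc u
    c+1+s≡u+1 = trans (ring c (+ s)) (trans (cong (λ z → + 1 ℤ.+ z) c+s≡u) (sym (ℤP.pos-+ 1 u)))

  defect-suc : ∀ k s → defect (k , s) ⊕ mulφ 1 ≡ defect (suc k , s)
  defect-suc k s = cong₂ _,_ (ℤP.+-identityʳ (- + s)) (trans (sym (ℤP.pos-+ k 1)) (cong +_ (+-comm k 1)))

  defect-pred : ∀ k s → defect (suc k , s) ⊖ mulφ 1 ≡ defect (k , s)
  defect-pred k s = cong₂ _,_ (ℤP.+-identityʳ (- + s)) refl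

  2≤lucas-suc-suc : ∀ j → 2 ≤ lucas (suc (suc j))
  2≤lucas-suc-suc j = +-mono-≤ (lucas>0 (suc j)) (lucas>0 j)

  lucas-evenIdx≥2 : ∀ t → 2 ≤ lucas (evenIdx t)
  lucas-evenIdx≥2 zero = s≤s (s≤s z≤n)
  lucas-evenIdx≥2 (suc t) = 2≤lucas-suc-suc (suc (oddIdx t))

  ≥2⇒≡suc-suc : ∀ {n} → 2 ≤ n → Σ ℕ λ m → n ≡ suc (suc m)
  ≥2⇒≡suc-suc (s≤s (s≤s {n = m} _)) = m , refl

  lucas≡suc : ∀ j → Σ ℕ λ u → lucas j ≡ suc u
  lucas≡suc j with lucas j | lucas>0 j
  ... | suc u | _ = u , refl

  floorφ-lucas-odd : ∀ t → floorφ (lucas (oddIdx t)) + 1 ≡ lucas (evenIdx t)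
  floorφ-lucas-odd t with lucas≡suc (evenIdx t) | lucasDefect-odd t
  ... | u , L′≡u+1 | lower , upper =
    trans (cong (_+ 1) (floorφ-unique (lucas>0 (oddIdx t))
            (Floorφ-from-defect _ _ u (- + 1) (cong (λ L′ → - + 1 ℤ.+ + L′) L′≡u+1)
              (<φ-trans (<φ-byEvaluation (ι (- + 1)) (+ 1 , - + 1) 6) lower) upper)))
          (trans (+-comm u 1) (sym L′≡u+1))

  floorφ-lucas-even : ∀ t → floorφ (lucas (evenIdx t)) ≡ lucas (oddIdx (suc t))
  floorφ-lucas-even t with lucasDefect-even t
  ... | lower , upper = floorφ-unique (lucas>0 (evenIdx t))
    (Floorφ-from-defect _ _ _ (+ 0) (ℤP.+-identityˡ _) lower
      (<φ-trans upper (<φ-byEvaluation (- + 1 , + 1) (ι (+ 1)) 6)))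

  floorφ-lucas-odd+1 : ∀ t → floorφ (lucas (oddIdx t) + 1) ≡ lucas (evenIdx t) + 1
  floorφ-lucas-odd+1 t with lucasDefect-odd t
  ... | lower , upper = floorφ-unique (subst (1 ≤_) (+-comm 1 L) (s≤s z≤n)) (subst (λ k → Floorφ k (L′ + 1)) (+-comm 1 L)
    (Floorφ-from-defect _ _ _ (+ 1) (trans (sym (ℤP.pos-+ 1 L′)) (cong +_ (+-comm 1 L′)))
      (subst (ι (+ 1) <φ_) (defect-suc L L′) (⊕-monoˡ-< (mulφ 1) lower))
      (subst (_<φ ι (+ 2)) (defect-suc L L′) (<φ-trans (⊕-monoˡ-< (mulφ 1) upper) (<φ-byEvaluation (mulφ 1) (ι (+ 2)) 6)))))
    where
    L = lucas (oddIdx t)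
    L′ = lucas (evenIdx t)

  floorφ-lucas-even∸1 : ∀ t → floorφ (lucas (evenIdx t) ∸ 1) + 2 ≡ lucas (oddIdx (suc t))
  floorφ-lucas-even∸1 t
    with ≥2⇒≡suc-suc (lucas-evenIdx≥2 t) | ≥2⇒≡suc-suc (2≤lucas-suc-suc (oddIdx t)) | lucasDefect-even t
  ... | l , L≡l+2 | u , L′≡u+2 | lower , upper =
    trans (cong (λ L → floorφ (L ∸ 1) + 2) L≡l+2)
          (trans (cong (_+ 2) (floorφ-unique (s≤s z≤n) ⌊[l+1]φ⌋≡u)) (trans (+-comm u 2) (sym L′≡u+2)))
    where
    L′ = lucas (oddIdx (suc t))
    x = defect (suc (suc l) , L′)
    bounds : (ι (+ 0) <φ x) × (x <φ (- + 1 , + 1))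
    bounds = subst (λ L → (ι (+ 0) <φ defect (L , L′)) × (defect (L , L′) <φ (- + 1 , + 1))) L≡l+2 (lower , upper)
    ⌊[l+1]φ⌋≡u : Floorφ (suc l) u
    ⌊[l+1]φ⌋≡u = Floorφ-from-defect (suc l) L′ u (- + 2) (cong (λ s → - + 2 ℤ.+ + s) L′≡u+2)
      (subst (ι (- + 2) <φ_) (defect-pred (suc l) L′)
        (<φ-trans (<φ-byEvaluation (ι (- + 2)) (ι (+ 0) ⊖ mulφ 1) 6) (⊕-monoˡ-< (⊝ (mulφ 1)) (proj₁ bounds))))
      (subst (_<φ ι (- + 1)) (defect-pred (suc l) L′) (⊕-monoˡ-< (⊝ (mulφ 1)) (proj₂ bounds)))

  lucas-<-suc : ∀ j → 1 ≤ j → lucas j < lucas (suc j)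
  lucas-<-suc (suc j) _ = m<m+n (lucas (suc j)) (lucas>0 j)

  lucas-mono-< : ∀ {i j} → 1 ≤ i → i < j → lucas i < lucas j
  lucas-mono-< {suc i} {suc j} _ (s≤s i<j) =
    mono-suc⇒mono (λ n → lucas (suc n)) (λ n → lucas-<-suc (suc n) (s≤s z≤n)) i<j

  lucas-mono-≤ : ∀ {i j} → 1 ≤ i → i ≤ j → lucas i ≤ lucas j
  lucas-mono-≤ 1≤i i≤j with m≤n⇒m<n∨m≡n i≤j
  ... | inj₁ i<j = <⇒≤ (lucas-mono-< 1≤i i<j)
  ... | inj₂ refl = ≤-refl

  lucas-injective : ∀ {i j} → 1 ≤ i → 1 ≤ j → lucas i ≡ lucas j → i ≡ j
  lucas-injective {suc i} {suc j} _ _ eq =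
    cong suc (mono⇒injective (λ n → lucas (suc n)) (λ i<j → lucas-mono-< (s≤s z≤n) (s≤s i<j)) eq)

  lucas-gap : ∀ j → 3 ≤ j → suc (lucas j) < lucas (suc j)
  lucas-gap (suc j) (s≤s 2≤j) =
    subst (suc (lucas (suc j)) <_) (+-comm (lucas j) (lucas (suc j)))
          (+-monoˡ-< (lucas (suc j)) (lucas-mono-< {1} (s≤s z≤n) 2≤j))

  lucas-nonconsecutive : ∀ i j → 3 ≤ j → lucas i ≢ suc (lucas j)
  lucas-nonconsecutive zero j 3≤j eq =
    <-irrefl (suc-injective eq) (≤-trans (s≤s (s≤s z≤n)) (lucas-mono-≤ {3} (s≤s z≤n) 3≤j))
  lucas-nonconsecutive (suc i) j 3≤j eq with <-cmp (suc i) j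
  ... | tri< i<j _ _ = <-irrefl eq (m<n⇒m<1+n (lucas-mono-< (s≤s z≤n) i<j))
  ... | tri≈ _ refl _ = <-irrefl eq (n<1+n (lucas j))
  ... | tri> _ _ j<i = <-irrefl (sym eq) (<-≤-trans (lucas-gap j 3≤j) (lucas-mono-≤ (s≤s z≤n) j<i))

  oddIdx≥3 : ∀ t → 3 ≤ oddIdx t
  oddIdx≥3 zero = ≤-refl
  oddIdx≥3 (suc t) = ≤-trans (oddIdx≥3 t) (≤-trans (n≤1+n _) (n≤1+n _))

  oddIdx≢evenIdx : ∀ t t′ → oddIdx t ≢ evenIdx t′
  oddIdx≢evenIdx zero t′ eq = <-irrefl (suc-injective eq) (oddIdx≥3 t′)
  oddIdx≢evenIdx (suc t) zero eq = <-irrefl (sym (suc-injective (suc-injective eq))) (oddIdx≥3 t)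
  oddIdx≢evenIdx (suc t) (suc t′) eq = oddIdx≢evenIdx t t′ (suc-injective (suc-injective eq))

  lucas-oddIdx≥4 : ∀ t → 4 ≤ lucas (oddIdx t)
  lucas-oddIdx≥4 t = lucas-mono-≤ {3} (s≤s z≤n) (oddIdx≥3 t)

  lucas-evenIdx≥4 : ∀ t → 4 ≤ lucas (evenIdx t)
  lucas-evenIdx≥4 t = lucas-mono-≤ {3} (s≤s z≤n) (≤-trans (oddIdx≥3 t) (n≤1+n _))

  floorφ-lucas-odd-jump : ∀ t → floorφ (lucas (oddIdx t) + 1) ≡ floorφ (lucas (oddIdx t)) + 2
  floorφ-lucas-odd-jump t =
    trans (floorφ-lucas-odd+1 t) (trans (cong (_+ 1) (sym (floorφ-lucas-odd t))) (+-assoc _ 1 1))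

  floorφ-lucas-even-jump : ∀ t → floorφ (lucas (evenIdx t)) ≡ floorφ (lucas (evenIdx t) ∸ 1) + 2
  floorφ-lucas-even-jump t = trans (floorφ-lucas-even t) (sym (floorφ-lucas-even∸1 t))

  floorφ²-lucas-even : ∀ t → floorφ² (lucas (evenIdx t)) ≡ lucas (evenIdx (suc t))
  floorφ²-lucas-even t = cong (_+ lucas (evenIdx t)) (floorφ-lucas-even t)

  floorφ²-lucas-odd : ∀ t → floorφ² (lucas (oddIdx t)) + 1 ≡ lucas (oddIdx (suc t))
  floorφ²-lucas-odd t = trans (+-assoc _ (lucas (oddIdx t)) 1)
    (trans (cong (λ x → floorφ (lucas (oddIdx t)) + x) (+-comm (lucas (oddIdx t)) 1))
      (trans (sym (+-assoc _ 1 (lucas (oddIdx t)))) (cong (_+ lucas (oddIdx t)) (floorφ-lucas-odd t))))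

module LucasAutomaton where

  open import Data.Nat using (ℕ; zero; suc; _+_; _∸_)
  open import Data.Nat.Properties using (m+n∸n≡m)
  open import Data.Nat.Tactic.RingSolver using (solve-∀)
  open import Data.Product using (Σ; _,_; proj₁; _×_)
  open import Data.Sum using (_⊎_; inj₁; inj₂)
  open import Data.Bool using (Bool; true; false)
  open import Data.List using (List; []; _∷_; foldl; _++_)
  import Data.List.Properties as List
  open import Data.Fin using (Fin; toℕ; #_)
  open import Data.Vec using (Vec; lookup) renaming ([] to []ᵛ; _∷_ to _∷ᵛ_)
  open import Data.Unit using (⊤; tt)
  open import Relation.Binary.PropositionalEquality
  open FibonacciWords
  open ZeckendorfRepresentation
  open FloorSequence
  open Lucas

  -- Up to leading zeros, state qw is reached exactly by the words matching w ([10]* and [10]⁺ as in regular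
  -- expressions); the states r… collect the remaining admissible words, by suffix.
  data State : Set where
    qε q1 q10 q101 q100 q100[10]⁺ q100[10]*1 q100[10]*0 q100[10]*01 q100[10]*00 q100[10]*010 r1 r10 r00 dead : State

  δ : State → Bool → State
  δ qε false = qε
  δ qε true = q1
  δ q1 false = q10
  δ q10 false = q100
  δ q10 true = q101
  δ q101 false = r10
  δ q100 false = q100[10]*0
  δ q100 true = q100[10]*1
  δ q100[10]⁺ false = q100[10]*0
  δ q100[10]⁺ true = q100[10]*1
  δ q100[10]*1 false = q100[10]⁺
  δ q100[10]*0 false = q100[10]*00
  δ q100[10]*0 true = q100[10]*01
  δ q100[10]*01 false = q100[10]*010
  δ q100[10]*00 false = r00
  δ q100[10]*00 true = r1
  δ q100[10]*010 false = r00
  δ q100[10]*010 true = r1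
  δ r1 false = r10
  δ r10 false = r00
  δ r10 true = r1
  δ r00 false = r00
  δ r00 true = r1
  δ _ true = dead
  δ dead false = dead

  suffixOfState : State → Suffix
  suffixOfState qε = ends00
  suffixOfState q1 = ends1
  suffixOfState q10 = ends10
  suffixOfState q101 = ends1
  suffixOfState q100 = ends00
  suffixOfState q100[10]⁺ = ends10
  suffixOfState q100[10]*1 = ends1
  suffixOfState q100[10]*0 = ends00
  suffixOfState q100[10]*01 = ends1
  suffixOfState q100[10]*00 = ends00
  suffixOfState q100[10]*010 = ends10
  suffixOfState r1 = ends1
  suffixOfState r10 = ends10
  suffixOfState r00 = ends00
  suffixOfState dead = has11

  data LucasMark : Set where
    unmarked atOddLucas atEvenLucas : LucasMark

  mark : State → LucasMark
  mark q1 = atOddLucas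
  mark q100[10]*00 = atOddLucas
  mark q101 = atEvenLucas
  mark q100[10]*010 = atEvenLucas
  mark _ = unmarked

  oddBit evenBit : LucasMark → ℕ
  oddBit atOddLucas = 1
  oddBit _ = 0
  evenBit atEvenLucas = 1
  evenBit _ = 0

  output : State → Fin 3
  output q1 = # 2
  output q10 = # 2
  output q101 = # 0
  output q100[10]⁺ = # 2
  output q100[10]*00 = # 2
  output r10 = # 2
  output _ = # 1

  output-spec : ∀ q → toℕ (output q) + evenBit (mark q) ≡ 1 + isEnds10 (suffixOfState q) + oddBit (mark q)
  output-spec qε = refl
  output-spec q1 = refl
  output-spec q10 = refl
  output-spec q101 = refl
  output-spec q100 = refl
  output-spec q100[10]⁺ = refl
  output-spec q100[10]*1 = refl
  output-spec q100[10]*0 = refl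
  output-spec q100[10]*01 = refl
  output-spec q100[10]*00 = refl
  output-spec q100[10]*010 = refl
  output-spec r1 = refl
  output-spec r10 = refl
  output-spec r00 = refl
  output-spec dead = refl

  states : Vec State 15
  states = qε ∷ᵛ q1 ∷ᵛ q10 ∷ᵛ q101 ∷ᵛ q100 ∷ᵛ q100[10]⁺ ∷ᵛ q100[10]*1 ∷ᵛ q100[10]*0 ∷ᵛ q100[10]*01 ∷ᵛ
           q100[10]*00 ∷ᵛ q100[10]*010 ∷ᵛ r1 ∷ᵛ r10 ∷ᵛ r00 ∷ᵛ dead ∷ᵛ []ᵛ

  index : State → Fin 15
  index qε = # 0
  index q1 = # 1
  index q10 = # 2
  index q101 = # 3
  index q100 = # 4
  index q100[10]⁺ = # 5
  index q100[10]*1 = # 6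
  index q100[10]*0 = # 7
  index q100[10]*01 = # 8
  index q100[10]*00 = # 9
  index q100[10]*010 = # 10
  index r1 = # 11
  index r10 = # 12
  index r00 = # 13
  index dead = # 14

  lookup-index : ∀ q → lookup states (index q) ≡ q
  lookup-index qε = refl
  lookup-index q1 = refl
  lookup-index q10 = refl
  lookup-index q101 = refl
  lookup-index q100 = refl
  lookup-index q100[10]⁺ = refl
  lookup-index q100[10]*1 = refl
  lookup-index q100[10]*0 = refl
  lookup-index q100[10]*01 = refl
  lookup-index q100[10]*00 = refl
  lookup-index q100[10]*010 = refl
  lookup-index r1 = refl
  lookup-index r10 = refl
  lookup-index r00 = refl
  lookup-index dead = refl

  automaton : DFAO (Fin 3)
  automaton = record
    { Q = 15
    ; start = index qε
    ; δ = λ i b → index (δ (lookup states i) b)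
    ; out = λ i → output (lookup states i)
    }

  runState : List Bool → State
  runState = foldl δ qε

  run-index : ∀ w q → foldl (DFAO.δ automaton) (index q) w ≡ index (foldl δ q w)
  run-index [] q = refl
  run-index (b ∷ w) q rewrite lookup-index q = run-index w (δ q b)

  evalF-automaton : ∀ n → evalF automaton n ≡ output (runState (repF n))
  evalF-automaton n rewrite run-index (repF n) qε = cong output (lookup-index (runState (repF n)))

  suffixOfState-δ : ∀ q b → suffixOfState (δ q b) ≡ suffixStep (suffixOfState q) b
  suffixOfState-δ qε false = refl
  suffixOfState-δ qε true = refl
  suffixOfState-δ q1 false = refl
  suffixOfState-δ q1 true = refl
  suffixOfState-δ q10 false = refl
  suffixOfState-δ q10 true = refl
  suffixOfState-δ q101 false = refl
  suffixOfState-δ q101 true = refl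
  suffixOfState-δ q100 false = refl
  suffixOfState-δ q100 true = refl
  suffixOfState-δ q100[10]⁺ false = refl
  suffixOfState-δ q100[10]⁺ true = refl
  suffixOfState-δ q100[10]*1 false = refl
  suffixOfState-δ q100[10]*1 true = refl
  suffixOfState-δ q100[10]*0 false = refl
  suffixOfState-δ q100[10]*0 true = refl
  suffixOfState-δ q100[10]*01 false = refl
  suffixOfState-δ q100[10]*01 true = refl
  suffixOfState-δ q100[10]*00 false = refl
  suffixOfState-δ q100[10]*00 true = refl
  suffixOfState-δ q100[10]*010 false = refl
  suffixOfState-δ q100[10]*010 true = refl
  suffixOfState-δ r1 false = refl
  suffixOfState-δ r1 true = refl
  suffixOfState-δ r10 false = refl
  suffixOfState-δ r10 true = refl
  suffixOfState-δ r00 false = refl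
  suffixOfState-δ r00 true = refl
  suffixOfState-δ dead false = refl
  suffixOfState-δ dead true = refl

  suffixOfState-foldl : ∀ w q → suffixOfState (foldl δ q w) ≡ foldl suffixStep (suffixOfState q) w
  suffixOfState-foldl [] q = refl
  suffixOfState-foldl (b ∷ w) q rewrite sym (suffixOfState-δ q b) = suffixOfState-foldl w (δ q b)

  suffixOfState-runState : ∀ w → suffixOfState (runState w) ≡ suffixOf w
  suffixOfState-runState w = suffixOfState-foldl w qε

  StemValues : ℕ → ℕ × ℕ → Set
  StemValues t (m , s) = (m + 1 ≡ lucas (oddIdx t)) × (s + 2 ≡ lucas (evenIdx t))

  ValuesAt : State → ℕ × ℕ → Set
  ValuesAt qε v = v ≡ (0 , 0)
  ValuesAt q1 v = v ≡ (1 , 2)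
  ValuesAt q10 v = v ≡ (2 , 3)
  ValuesAt q101 v = v ≡ (4 , 7)
  ValuesAt q100 v = Σ ℕ λ t → StemValues t v
  ValuesAt q100[10]⁺ v = Σ ℕ λ t → StemValues t v
  ValuesAt q100[10]*1 (m , s) = Σ ℕ λ t → (m + 1 ≡ lucas (evenIdx t)) × (s + 1 ≡ lucas (oddIdx (suc t)))
  ValuesAt q100[10]*0 (m , s) = Σ ℕ λ t → (m + 2 ≡ lucas (evenIdx t)) × (s + 3 ≡ lucas (oddIdx (suc t)))
  ValuesAt q100[10]*01 (m , s) =
    Σ ℕ λ t → (m + 2 ≡ lucas (oddIdx (suc t))) × (s + 3 ≡ lucas (evenIdx (suc t)))
  ValuesAt q100[10]*00 (m , s) =
    Σ ℕ λ t → (m + 3 ≡ lucas (oddIdx (suc t))) × (s + 5 ≡ lucas (evenIdx (suc t)))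
  ValuesAt q100[10]*010 (m , s) =
    Σ ℕ λ t → (m + 3 ≡ lucas (evenIdx (suc t))) × (s + 5 ≡ lucas (oddIdx (suc (suc t))))
  ValuesAt _ v = ⊤

  private
    stem-0 : ∀ t m s → StemValues t (m , s) → ValuesAt q100[10]*0 (readDigit (m , s) false)
    stem-0 t m s (e₁ , e₂) = t , trans (ring₁ s) e₂ , trans (ring₂ s m) (cong₂ _+_ e₂ e₁)
      where
      ring₁ : ∀ s → s + 0 + 2 ≡ s + 2
      ring₁ = solve-∀
      ring₂ : ∀ s m → s + m + 0 + 3 ≡ (s + 2) + (m + 1)
      ring₂ = solve-∀
    stem-1 : ∀ t m s → StemValues t (m , s) → ValuesAt q100[10]*1 (readDigit (m , s) true)
    stem-1 t m s (e₁ , e₂) = t , trans (ring₁ s) e₂ , trans (ring₂ s m) (cong₂ _+_ e₂ e₁)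
      where
      ring₁ : ∀ s → s + 1 + 1 ≡ s + 2
      ring₁ = solve-∀
      ring₂ : ∀ s m → s + m + 2 + 1 ≡ (s + 2) + (m + 1)
      ring₂ = solve-∀

    read0-from-+2+3 : ∀ m s {A B} → m + 2 ≡ A → s + 3 ≡ B → (s + 0 + 3 ≡ B) × (s + m + 0 + 5 ≡ B + A)
    read0-from-+2+3 m s e₁ e₂ = trans (ring₁ s) e₂ , trans (ring₂ s m) (cong₂ _+_ e₂ e₁)
      where
      ring₁ : ∀ s → s + 0 + 3 ≡ s + 3
      ring₁ = solve-∀
      ring₂ : ∀ s m → s + m + 0 + 5 ≡ (s + 3) + (m + 2)
      ring₂ = solve-∀

  ValuesAt-δ : ∀ q v b → ValuesAt q v → ValuesAt (δ q b) (readDigit v b)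
  ValuesAt-δ qε v false refl = refl
  ValuesAt-δ qε v true refl = refl
  ValuesAt-δ q1 v false refl = refl
  ValuesAt-δ q1 v true _ = tt
  ValuesAt-δ q10 v false refl = 0 , refl , refl
  ValuesAt-δ q10 v true refl = refl
  ValuesAt-δ q101 v false _ = tt
  ValuesAt-δ q101 v true _ = tt
  ValuesAt-δ q100 (m , s) false (t , e) = stem-0 t m s e
  ValuesAt-δ q100 (m , s) true (t , e) = stem-1 t m s e
  ValuesAt-δ q100[10]⁺ (m , s) false (t , e) = stem-0 t m s e
  ValuesAt-δ q100[10]⁺ (m , s) true (t , e) = stem-1 t m s e
  ValuesAt-δ q100[10]*1 (m , s) false (t , e₁ , e₂) =
    suc t , trans (ring₁ s) e₂ , trans (ring₂ s m) (cong₂ _+_ e₂ e₁)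
    where
    ring₁ : ∀ s → s + 0 + 1 ≡ s + 1
    ring₁ = solve-∀
    ring₂ : ∀ s m → s + m + 0 + 2 ≡ (s + 1) + (m + 1)
    ring₂ = solve-∀
  ValuesAt-δ q100[10]*1 v true _ = tt
  ValuesAt-δ q100[10]*0 (m , s) false (t , e₁ , e₂) = t , read0-from-+2+3 m s e₁ e₂
  ValuesAt-δ q100[10]*0 (m , s) true (t , e₁ , e₂) =
    t , trans (ring₁ s) e₂ , trans (ring₂ s m) (cong₂ _+_ e₂ e₁)
    where
    ring₁ : ∀ s → s + 1 + 2 ≡ s + 3
    ring₁ = solve-∀
    ring₂ : ∀ s m → s + m + 2 + 3 ≡ (s + 3) + (m + 2)
    ring₂ = solve-∀
  ValuesAt-δ q100[10]*01 (m , s) false (t , e₁ , e₂) = t , read0-from-+2+3 m s e₁ e₂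
  ValuesAt-δ q100[10]*01 v true _ = tt
  ValuesAt-δ q100[10]*00 v false _ = tt
  ValuesAt-δ q100[10]*00 v true _ = tt
  ValuesAt-δ q100[10]*010 v false _ = tt
  ValuesAt-δ q100[10]*010 v true _ = tt
  ValuesAt-δ r1 v false _ = tt
  ValuesAt-δ r1 v true _ = tt
  ValuesAt-δ r10 v false _ = tt
  ValuesAt-δ r10 v true _ = tt
  ValuesAt-δ r00 v false _ = tt
  ValuesAt-δ r00 v true _ = tt
  ValuesAt-δ dead v false _ = tt
  ValuesAt-δ dead v true _ = tt

  ValuesAt-foldl : ∀ w q v → ValuesAt q v → ValuesAt (foldl δ q w) (foldl readDigit v w)
  ValuesAt-foldl [] q v h = h
  ValuesAt-foldl (b ∷ w) q v h = ValuesAt-foldl w (δ q b) (readDigit v b) (ValuesAt-δ q v b h)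

  ValuesAt-runState : ∀ w → ValuesAt (runState w) (values w)
  ValuesAt-runState w = ValuesAt-foldl w qε (0 , 0) refl

  LucasIndexed : LucasMark → ℕ → Set
  LucasIndexed unmarked n = ⊤
  LucasIndexed atOddLucas n = Σ ℕ λ t → n + 3 ≡ lucas (oddIdx t)
  LucasIndexed atEvenLucas n = Σ ℕ λ t → n + 3 ≡ lucas (evenIdx t)

  mark-sound : ∀ q v → ValuesAt q v → LucasIndexed (mark q) (proj₁ v)
  mark-sound q1 _ refl = 0 , refl
  mark-sound q101 _ refl = 0 , refl
  mark-sound q100[10]*00 _ (t , e , _) = suc t , e
  mark-sound q100[10]*010 _ (t , e , _) = suc t , e
  mark-sound qε _ _ = tt
  mark-sound q10 _ _ = tt
  mark-sound q100 _ _ = tt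
  mark-sound q100[10]⁺ _ _ = tt
  mark-sound q100[10]*1 _ _ = tt
  mark-sound q100[10]*0 _ _ = tt
  mark-sound q100[10]*01 _ _ = tt
  mark-sound r1 _ _ = tt
  mark-sound r10 _ _ = tt
  mark-sound r00 _ _ = tt
  mark-sound dead _ _ = tt

  mark-runState : ∀ w → LucasIndexed (mark (runState w)) (value w)
  mark-runState w = mark-sound (runState w) (values w) (ValuesAt-runState w)

  lucasStem : ℕ → List Bool
  lucasStem zero = false ∷ false ∷ []
  lucasStem (suc t) = lucasStem t ++ true ∷ false ∷ []

  oddLucasWord evenLucasWord : ℕ → List Bool
  oddLucasWord t = true ∷ (lucasStem t ++ false ∷ false ∷ [])
  evenLucasWord t = true ∷ (lucasStem t ++ false ∷ true ∷ false ∷ [])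

  runState-stem : ∀ t → (foldl δ q1 (lucasStem t) ≡ q100) ⊎ (foldl δ q1 (lucasStem t) ≡ q100[10]⁺)
  runState-stem zero = inj₁ refl
  runState-stem (suc t) rewrite List.foldl-++ δ q1 (lucasStem t) (true ∷ false ∷ []) with runState-stem t
  ... | inj₁ e rewrite e = inj₂ refl
  ... | inj₂ e rewrite e = inj₂ refl

  values-stem : ∀ t → StemValues t (foldl readDigit (1 , 2) (lucasStem t))
  values-stem zero = refl , refl
  values-stem (suc t) rewrite List.foldl-++ readDigit (1 , 2) (lucasStem t) (true ∷ false ∷ [])
    with foldl readDigit (1 , 2) (lucasStem t) | values-stem t
  ... | (m , s) | e₁ , e₂ =
    trans (ring₁ s m) (cong₂ _+_ e₂ e₁) , trans (ring₂ s m) (cong₂ _+_ (cong₂ _+_ e₂ e₁) e₂)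
    where
    ring₁ : ∀ s m → s + m + 2 + 0 + 1 ≡ (s + 2) + (m + 1)
    ring₁ = solve-∀
    ring₂ : ∀ s m → s + m + 2 + (s + 1) + 0 + 2 ≡ ((s + 2) + (m + 1)) + (s + 2)
    ring₂ = solve-∀

  runState-oddLucasWord : ∀ t → runState (oddLucasWord t) ≡ q100[10]*00
  runState-oddLucasWord t rewrite List.foldl-++ δ q1 (lucasStem t) (false ∷ false ∷ []) with runState-stem t
  ... | inj₁ e rewrite e = refl
  ... | inj₂ e rewrite e = refl

  runState-evenLucasWord : ∀ t → runState (evenLucasWord t) ≡ q100[10]*010
  runState-evenLucasWord t
    rewrite List.foldl-++ δ q1 (lucasStem t) (false ∷ true ∷ false ∷ []) with runState-stem t
  ... | inj₁ e rewrite e = refl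
  ... | inj₂ e rewrite e = refl

  value-oddLucasWord : ∀ t → value (oddLucasWord t) + 3 ≡ lucas (oddIdx (suc t))
  value-oddLucasWord t rewrite List.foldl-++ readDigit (1 , 2) (lucasStem t) (false ∷ false ∷ [])
    with foldl readDigit (1 , 2) (lucasStem t) | values-stem t
  ... | (m , s) | e₁ , e₂ = trans (ring s m) (cong₂ _+_ e₂ e₁)
    where
    ring : ∀ s m → s + m + 0 + 0 + 3 ≡ (s + 2) + (m + 1)
    ring = solve-∀

  value-evenLucasWord : ∀ t → value (evenLucasWord t) + 3 ≡ lucas (evenIdx (suc t))
  value-evenLucasWord t rewrite List.foldl-++ readDigit (1 , 2) (lucasStem t) (false ∷ true ∷ false ∷ [])
    with foldl readDigit (1 , 2) (lucasStem t) | values-stem t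
  ... | (m , s) | e₁ , e₂ = trans (ring s m) (cong₂ _+_ (cong₂ _+_ e₂ e₁) e₂)
    where
    ring : ∀ s m → s + m + 0 + (s + 0) + 2 + 0 + 3 ≡ ((s + 2) + (m + 1)) + (s + 2)
    ring = solve-∀

  admissible-runState : ∀ w q → runState w ≡ q → suffixOfState q ≢ has11 → suffixOf w ≢ has11
  admissible-runState w q w↦q q-ok w11 =
    q-ok (trans (cong suffixOfState (sym w↦q)) (trans (suffixOfState-runState w) w11))

  +3≡⇒∸3≡ : ∀ {x y} → x + 3 ≡ y → y ∸ 3 ≡ x
  +3≡⇒∸3≡ {x} refl = m+n∸n≡m x 3

  mark-repF-odd : ∀ t → mark (runState (repF (lucas (oddIdx t) ∸ 3))) ≡ atOddLucas
  mark-repF-odd zero = refl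
  mark-repF-odd (suc t) = begin
    mark (runState (repF (lucas (oddIdx (suc t)) ∸ 3)))
      ≡⟨ cong (λ n → mark (runState (repF n))) (+3≡⇒∸3≡ (value-oddLucasWord t)) ⟩
    mark (runState (repF (value (oddLucasWord t))))
      ≡⟨ cong (λ w → mark (runState w)) (repF-value (lucasStem t ++ false ∷ false ∷ []) admissible) ⟩
    mark (runState (oddLucasWord t))
      ≡⟨ cong mark (runState-oddLucasWord t) ⟩
    atOddLucas ∎
    where
    open ≡-Reasoning
    admissible : suffixOf (oddLucasWord t) ≢ has11
    admissible = admissible-runState (oddLucasWord t) _ (runState-oddLucasWord t) (λ ())

  mark-repF-even : ∀ t → mark (runState (repF (lucas (evenIdx t) ∸ 3))) ≡ atEvenLucas
  mark-repF-even zero = refl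
  mark-repF-even (suc t) = begin
    mark (runState (repF (lucas (evenIdx (suc t)) ∸ 3)))
      ≡⟨ cong (λ n → mark (runState (repF n))) (+3≡⇒∸3≡ (value-evenLucasWord t)) ⟩
    mark (runState (repF (value (evenLucasWord t))))
      ≡⟨ cong (λ w → mark (runState w)) (repF-value (lucasStem t ++ false ∷ true ∷ false ∷ []) admissible) ⟩
    mark (runState (evenLucasWord t))
      ≡⟨ cong mark (runState-evenLucasWord t) ⟩
    atEvenLucas ∎
    where
    open ≡-Reasoning
    admissible : suffixOf (evenLucasWord t) ≢ has11
    admissible = admissible-runState (evenLucasWord t) _ (runState-evenLucasWord t) (λ ())

module PerturbedSequence where

  open import Data.Nat using (ℕ; suc; _+_; _∸_; _≤_; s≤s; z≤n)
  open import Data.Nat.Properties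
  open import Data.Nat.Tactic.RingSolver using (solve-∀)
  open import Data.Product using (_,_)
  open import Data.Fin using (toℕ)
  open import Relation.Binary.PropositionalEquality
  open FibonacciWords
  open ZeckendorfRepresentation
  open FloorSequence
  open Lucas
  open LucasAutomaton

  correction : ℕ → ℕ
  correction n = toℕ (evalF automaton n)

  markAt : ℕ → LucasMark
  markAt n = mark (runState (repF (n + 1)))

  a b : ℕ → ℕ
  a n = floorφ (n + 2) + correction (n + 1) ∸ 1
  b n = a n + n + 4

  a+1 : ∀ n → a n + 1 ≡ floorφ (n + 2) + correction (n + 1)
  a+1 n = m∸n+n≡m (≤-trans 1≤floorφ (m≤m+n _ _))
    where
    1≤floorφ : 1 ≤ floorφ (n + 2)
    1≤floorφ rewrite +-suc n 1 = subst (1 ≤_) (+-comm 1 _) (s≤s z≤n)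

  correction-spec : ∀ n →
                    correction (n + 1) + evenBit (markAt n) ≡ 1 + isEnds10 (suffixOf (repF (n + 1))) + oddBit (markAt n)
  correction-spec n = begin
    toℕ (evalF automaton (n + 1)) + evenBit (mark q)
      ≡⟨ cong (λ o → toℕ o + evenBit (mark q)) (evalF-automaton (n + 1)) ⟩
    toℕ (output q) + evenBit (mark q)
      ≡⟨ output-spec q ⟩
    1 + isEnds10 (suffixOfState q) + oddBit (mark q)
      ≡⟨ cong (λ c → 1 + isEnds10 c + oddBit (mark q)) (suffixOfState-runState (repF (n + 1))) ⟩
    1 + isEnds10 (suffixOf (repF (n + 1))) + oddBit (mark q) ∎
    where
    open ≡-Reasoning
    q = runState (repF (n + 1))

  a+3-vs-floorφ : ∀ n → a n + 3 + evenBit (markAt n) ≡ floorφ (n + 4) + oddBit (markAt n)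
  a+3-vs-floorφ n = begin
    a n + 3 + e                                    ≡⟨ ring₁ (a n) e ⟩
    (a n + 1) + (2 + e)                            ≡⟨ cong (_+ (2 + e)) (a+1 n) ⟩
    floorφ (n + 2) + correction (n + 1) + (2 + e)  ≡⟨ ring₂ (floorφ (n + 2)) (correction (n + 1)) e ⟩
    floorφ (n + 2) + 2 + (correction (n + 1) + e)  ≡⟨ cong (λ x → floorφ (n + 2) + 2 + x) (correction-spec n) ⟩
    floorφ (n + 2) + 2 + (1 + t + o)               ≡⟨ ring₃ (floorφ (n + 2)) t o ⟩
    floorφ (n + 2) + 3 + t + o                     ≡⟨ cong (λ k → floorφ k + 3 + t + o) (sym (+-assoc n 1 1)) ⟩
    floorφ (n + 1 + 1) + 3 + t + o                 ≡⟨ cong (_+ o) (sym (floorφ-+3 (n + 1))) ⟩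
    floorφ (n + 1 + 3) + o                         ≡⟨ cong (λ k → floorφ k + o) (+-assoc n 1 3) ⟩
    floorφ (n + 4) + o                             ∎
    where
    open ≡-Reasoning
    e = evenBit (markAt n)
    o = oddBit (markAt n)
    t = isEnds10 (suffixOf (repF (n + 1)))
    ring₁ : ∀ x e → x + 3 + e ≡ (x + 1) + (2 + e)
    ring₁ = solve-∀
    ring₂ : ∀ f c e → f + c + (2 + e) ≡ f + 2 + (c + e)
    ring₂ = solve-∀
    ring₃ : ∀ f t o → f + 2 + (1 + t + o) ≡ f + 3 + t + o
    ring₃ = solve-∀

  markAt-sound : ∀ n → LucasIndexed (markAt n) (n + 1)
  markAt-sound n = subst (LucasIndexed (markAt n)) (value-repF (n + 1)) (mark-runState (repF (n + 1)))

  markAt-odd : ∀ n t → n + 4 ≡ lucas (oddIdx t) → markAt n ≡ atOddLucas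
  markAt-odd n t n+4≡L =
    subst (λ m → mark (runState (repF m)) ≡ atOddLucas) (+3≡⇒∸3≡ (trans (+-assoc n 1 3) n+4≡L))
          (mark-repF-odd t)

  markAt-even : ∀ n t → n + 4 ≡ lucas (evenIdx t) → markAt n ≡ atEvenLucas
  markAt-even n t n+4≡L =
    subst (λ m → mark (runState (repF m)) ≡ atEvenLucas) (+3≡⇒∸3≡ (trans (+-assoc n 1 3) n+4≡L))
          (mark-repF-even t)

  data Shape (n : ℕ) : Set where
    regular   : markAt n ≡ unmarked → Shape n
    oddLucas  : ∀ t → n + 4 ≡ lucas (oddIdx t) → Shape n
    evenLucas : ∀ t → n + 4 ≡ lucas (evenIdx t) → Shape n

  shape : ∀ n → Shape n
  shape n with markAt n in eq | markAt-sound n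
  ... | unmarked | _ = regular eq
  ... | atOddLucas | t , n+1+3≡L = oddLucas t (trans (sym (+-assoc n 1 3)) n+1+3≡L)
  ... | atEvenLucas | t , n+1+3≡L = evenLucas t (trans (sym (+-assoc n 1 3)) n+1+3≡L)

  b+3 : ∀ n → b n + 3 ≡ (a n + 3) + (n + 4)
  b+3 n = ring (a n) n
    where
    ring : ∀ x n → x + n + 4 + 3 ≡ (x + 3) + (n + 4)
    ring = solve-∀

  b+4 : ∀ n → b n + 4 ≡ (a n + 4) + (n + 4)
  b+4 n = ring (a n) n
    where
    ring : ∀ x n → x + n + 4 + 4 ≡ (x + 4) + (n + 4)
    ring = solve-∀

  a+3-at : ∀ n {m} → markAt n ≡ m → a n + 3 + evenBit m ≡ floorφ (n + 4) + oddBit m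
  a+3-at n refl = a+3-vs-floorφ n

  a-regular : ∀ n → markAt n ≡ unmarked → a n + 3 ≡ floorφ (n + 4)
  a-regular n n-unmarked = begin
    a n + 3                             ≡⟨ sym (+-identityʳ _) ⟩
    a n + 3 + 0                         ≡⟨ a+3-at n n-unmarked ⟩
    floorφ (n + 4) + 0                  ≡⟨ +-identityʳ _ ⟩
    floorφ (n + 4)                      ∎
    where open ≡-Reasoning

  a-odd-floorφ : ∀ n t → n + 4 ≡ lucas (oddIdx t) → a n + 3 ≡ floorφ (n + 4) + 1
  a-odd-floorφ n t n+4≡L = trans (sym (+-identityʳ _)) (a+3-at n (markAt-odd n t n+4≡L))

  a-even-floorφ : ∀ n t → n + 4 ≡ lucas (evenIdx t) → a n + 4 ≡ floorφ (n + 4)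
  a-even-floorφ n t n+4≡L =
    trans (sym (+-assoc (a n) 3 1)) (trans (a+3-at n (markAt-even n t n+4≡L)) (+-identityʳ _))

  a-odd : ∀ n t → n + 4 ≡ lucas (oddIdx t) → a n + 3 ≡ lucas (evenIdx t)
  a-odd n t n+4≡L =
    trans (a-odd-floorφ n t n+4≡L) (trans (cong (λ k → floorφ k + 1) n+4≡L) (floorφ-lucas-odd t))

  a-even : ∀ n t → n + 4 ≡ lucas (evenIdx t) → a n + 4 ≡ lucas (oddIdx (suc t))
  a-even n t n+4≡L = trans (a-even-floorφ n t n+4≡L) (trans (cong floorφ n+4≡L) (floorφ-lucas-even t))

  b-regular : ∀ n → markAt n ≡ unmarked → b n + 3 ≡ floorφ² (n + 4)
  b-regular n n-unmarked = trans (b+3 n) (cong (_+ (n + 4)) (a-regular n n-unmarked))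

  b-odd : ∀ n t → n + 4 ≡ lucas (oddIdx t) → b n + 3 ≡ lucas (oddIdx (suc t))
  b-odd n t n+4≡L = trans (b+3 n) (cong₂ _+_ (a-odd n t n+4≡L) n+4≡L)

  b-even : ∀ n t → n + 4 ≡ lucas (evenIdx t) → b n + 4 ≡ lucas (evenIdx (suc t))
  b-even n t n+4≡L = trans (b+4 n) (cong₂ _+_ (a-even n t n+4≡L) n+4≡L)

  b-formula : ∀ n → b n ≡ floorφ² (n + 2) + correction (n + 1) + 1
  b-formula n = begin
    a n + n + 4                                      ≡⟨ ring₁ (a n) n ⟩
    (a n + 1) + (n + 3)                              ≡⟨ cong (_+ (n + 3)) (a+1 n) ⟩
    floorφ (n + 2) + correction (n + 1) + (n + 3)    ≡⟨ ring₂ (floorφ (n + 2)) (correction (n + 1)) n ⟩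
    floorφ (n + 2) + (n + 2) + correction (n + 1) + 1 ∎
    where
    open ≡-Reasoning
    ring₁ : ∀ x n → x + n + 4 ≡ (x + 1) + (n + 3)
    ring₁ = solve-∀
    ring₂ : ∀ f c n → f + c + (n + 3) ≡ f + (n + 2) + c + 1
    ring₂ = solve-∀

module Partition where

  open import Data.Nat using (ℕ; zero; suc; _+_; _∸_; _≤_; _<_; s≤s; z≤n)
  open import Data.Nat.Properties
  open import Data.Product using (Σ; _,_)
  open import Data.Sum using (_⊎_; inj₁; inj₂)
  open import Data.Empty using (⊥; ⊥-elim)
  open import Relation.Binary.PropositionalEquality
  open FloorSequence
  open Lucas
  open LucasAutomaton
  open PerturbedSequence

  1≤n+4 : ∀ n → 1 ≤ n + 4
  1≤n+4 n = ≤-trans (s≤s z≤n) (m≤n+m 4 n)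

  floorφ-jump-odd : ∀ n t → n + 4 ≡ lucas (oddIdx t) → floorφ (suc n + 4) ≡ floorφ (n + 4) + 2
  floorφ-jump-odd n t n+4≡L = begin
    floorφ (suc (n + 4))          ≡⟨ cong (λ k → floorφ (suc k)) n+4≡L ⟩
    floorφ (suc (lucas (oddIdx t)))  ≡⟨ cong floorφ (+-comm 1 (lucas (oddIdx t))) ⟩
    floorφ (lucas (oddIdx t) + 1) ≡⟨ floorφ-lucas-odd-jump t ⟩
    floorφ (lucas (oddIdx t)) + 2 ≡⟨ cong (λ k → floorφ k + 2) (sym n+4≡L) ⟩
    floorφ (n + 4) + 2            ∎
    where open ≡-Reasoning

  floorφ-jump-even : ∀ n t → suc n + 4 ≡ lucas (evenIdx t) → floorφ (suc n + 4) ≡ floorφ (n + 4) + 2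
  floorφ-jump-even n t n+5≡L = begin
    floorφ (suc n + 4)                   ≡⟨ cong floorφ n+5≡L ⟩
    floorφ (lucas (evenIdx t))           ≡⟨ floorφ-lucas-even-jump t ⟩
    floorφ (lucas (evenIdx t) ∸ 1) + 2   ≡⟨ cong (λ k → floorφ (k ∸ 1) + 2) (sym n+5≡L) ⟩
    floorφ (n + 4) + 2                   ∎
    where open ≡-Reasoning

  +4≡⇒+3< : ∀ {x A} → x + 4 ≡ A → x + 3 < A
  +4≡⇒+3< {x} x+4≡A = ≤-reflexive (trans (sym (+-suc x 3)) x+4≡A)

  +4≡+2⇒+3≡+1 : ∀ {x A} → x + 4 ≡ A + 2 → x + 3 ≡ A + 1
  +4≡+2⇒+3≡+1 {x} {A} eq = +-cancelʳ-≡ 1 _ _ (trans (+-assoc x 3 1) (trans eq (sym (+-assoc A 1 1))))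

  a-<-suc : ∀ n → a n < a (suc n)
  a-<-suc n = +-cancelʳ-< 3 (a n) (a (suc n)) (compare (shape n) (shape (suc n)))
    where
    A A′ : ℕ
    A = floorφ (n + 4)
    A′ = floorφ (suc n + 4)
    A<A′ : A < A′
    A<A′ = floorφ-mono-< (1≤n+4 n) (n<1+n (n + 4))
    A<A′+1 : A < A′ + 1
    A<A′+1 = ≤-trans A<A′ (m≤m+n A′ 1)
    compare : Shape n → Shape (suc n) → a n + 3 < a (suc n) + 3
    compare (regular r) (regular r′) = subst₂ _<_ (sym (a-regular n r)) (sym (a-regular (suc n) r′)) A<A′
    compare (regular r) (oddLucas t′ e′) =
      subst₂ _<_ (sym (a-regular n r)) (sym (a-odd-floorφ (suc n) t′ e′)) A<A′+1
    compare (regular r) (evenLucas t′ e′) =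
      subst₂ _<_ (sym (a-regular n r)) (sym a′+3≡A+1) (m<m+n A (s≤s z≤n))
      where
      a′+3≡A+1 : a (suc n) + 3 ≡ A + 1
      a′+3≡A+1 = +4≡+2⇒+3≡+1 (trans (a-even-floorφ (suc n) t′ e′) (floorφ-jump-even n t′ e′))
    compare (oddLucas t e) (regular r′) =
      subst₂ _<_ (sym (a-odd-floorφ n t e)) (sym a′+3≡A+2) (+-monoʳ-< A (s≤s (s≤s z≤n)))
      where
      a′+3≡A+2 : a (suc n) + 3 ≡ A + 2
      a′+3≡A+2 = trans (a-regular (suc n) r′) (floorφ-jump-odd n t e)
    compare (oddLucas t e) (oddLucas t′ e′) =
      subst₂ _<_ (sym (a-odd-floorφ n t e)) (sym (a-odd-floorφ (suc n) t′ e′)) (+-monoˡ-< 1 A<A′)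
    compare (oddLucas t e) (evenLucas t′ e′) =
      ⊥-elim (lucas-nonconsecutive (evenIdx t′) (oddIdx t) (oddIdx≥3 t) (trans (sym e′) (cong suc e)))
    compare (evenLucas t e) (regular r′) =
      <-trans (+4≡⇒+3< (a-even-floorφ n t e)) (subst (A <_) (sym (a-regular (suc n) r′)) A<A′)
    compare (evenLucas t e) (oddLucas t′ e′) =
      <-trans (+4≡⇒+3< (a-even-floorφ n t e)) (subst (A <_) (sym (a-odd-floorφ (suc n) t′ e′)) A<A′+1)
    compare (evenLucas t e) (evenLucas t′ e′) =
      ≤-pred (subst₂ _<_ (trans (sym (a-even-floorφ n t e)) (+-suc (a n) 3))
                         (trans (sym (a-even-floorφ (suc n) t′ e′)) (+-suc (a (suc n)) 3)) A<A′)

  regular-not-odd : ∀ n t → markAt n ≡ unmarked → n + 4 ≢ lucas (oddIdx t)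
  regular-not-odd n t r e with trans (sym r) (markAt-odd n t e)
  ... | ()

  regular-not-even : ∀ n t → markAt n ≡ unmarked → n + 4 ≢ lucas (evenIdx t)
  regular-not-even n t r e with trans (sym r) (markAt-even n t e)
  ... | ()

  +3≡⇒+4≡suc : ∀ {x y} → x + 3 ≡ y → x + 4 ≡ suc y
  +3≡⇒+4≡suc {x} eq = trans (+-suc x 3) (cong suc eq)

  +3≡⇒+4≡+1 : ∀ {x y} → x + 3 ≡ y → x + 4 ≡ y + 1
  +3≡⇒+4≡+1 {y = y} eq = trans (+3≡⇒+4≡suc eq) (+-comm 1 y)

  evenIdx≥3 : ∀ t → 3 ≤ evenIdx t
  evenIdx≥3 t = ≤-trans (oddIdx≥3 t) (n≤1+n _)

  a≢b-regular : ∀ m n → markAt m ≡ unmarked → Shape n → a m ≢ b n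
  a≢b-regular m n r (regular r′) eq =
    floorφ≢floorφ² (1≤n+4 m) (1≤n+4 n) (trans (sym (a-regular m r)) (trans (cong (_+ 3) eq) (b-regular n r′)))
  a≢b-regular m n r (oddLucas t e) eq =
    regular-not-even m t r (floorφ-injective (1≤n+4 m) (lucas>0 (evenIdx t)) (begin
      floorφ (m + 4)               ≡⟨ sym (a-regular m r) ⟩
      a m + 3                      ≡⟨ cong (_+ 3) eq ⟩
      b n + 3                      ≡⟨ b-odd n t e ⟩
      lucas (oddIdx (suc t))       ≡⟨ sym (floorφ-lucas-even t) ⟩
      floorφ (lucas (evenIdx t))   ∎))
    where open ≡-Reasoning
  a≢b-regular m n r (evenLucas t e) eq =
    regular-not-odd m (suc t) r (floorφ-injective (1≤n+4 m) (lucas>0 (oddIdx (suc t))) (+-cancelʳ-≡ 1 _ _ (begin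
      floorφ (m + 4) + 1                 ≡⟨ sym (+3≡⇒+4≡+1 (a-regular m r)) ⟩
      a m + 4                            ≡⟨ cong (_+ 4) eq ⟩
      b n + 4                            ≡⟨ b-even n t e ⟩
      lucas (evenIdx (suc t))            ≡⟨ sym (floorφ-lucas-odd (suc t)) ⟩
      floorφ (lucas (oddIdx (suc t))) + 1 ∎)))
    where open ≡-Reasoning

  a≢b-odd : ∀ m n t → m + 4 ≡ lucas (oddIdx t) → Shape n → a m ≢ b n
  a≢b-odd m n zero e (regular r′) eq =
    <-irrefl refl (<-≤-trans 7<10 (≤-trans 10≤floorφ² (≤-reflexive floorφ²≡7)))
    where
    7<10 : 7 < 10
    7<10 = s≤s (s≤s (s≤s (s≤s (s≤s (s≤s (s≤s (s≤s z≤n)))))))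
    10≤floorφ² : 10 ≤ floorφ² (n + 4)
    10≤floorφ² = floorφ²-mono-≤ {4} (s≤s z≤n) (m≤n+m 4 n)
    floorφ²≡7 : floorφ² (n + 4) ≡ 7
    floorφ²≡7 = trans (sym (b-regular n r′)) (trans (cong (_+ 3) (sym eq)) (a-odd m zero e))
  a≢b-odd m n (suc u) e (regular r′) eq =
    regular-not-even n u r′ (floorφ²-injective (1≤n+4 n) (lucas>0 (evenIdx u)) (begin
      floorφ² (n + 4)               ≡⟨ sym (b-regular n r′) ⟩
      b n + 3                       ≡⟨ cong (_+ 3) (sym eq) ⟩
      a m + 3                       ≡⟨ a-odd m (suc u) e ⟩
      lucas (evenIdx (suc u))       ≡⟨ sym (floorφ²-lucas-even u) ⟩
      floorφ² (lucas (evenIdx u))   ∎))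
    where open ≡-Reasoning
  a≢b-odd m n t e (oddLucas t′ e′) eq =
    oddIdx≢evenIdx (suc t′) t (sym (lucas-injective (s≤s z≤n) (s≤s z≤n)
      (trans (sym (a-odd m t e)) (trans (cong (_+ 3) eq) (b-odd n t′ e′)))))
  a≢b-odd m n t e (evenLucas t′ e′) eq =
    lucas-nonconsecutive (evenIdx (suc t′)) (evenIdx t) (evenIdx≥3 t)
      (trans (sym (b-even n t′ e′)) (trans (cong (_+ 4) (sym eq)) (+3≡⇒+4≡suc (a-odd m t e))))

  a≢b-even : ∀ m n t → m + 4 ≡ lucas (evenIdx t) → Shape n → a m ≢ b n
  a≢b-even m n t e (regular r′) eq =
    regular-not-odd n t r′ (floorφ²-injective (1≤n+4 n) (lucas>0 (oddIdx t)) (+-cancelʳ-≡ 1 _ _ (begin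
      floorφ² (n + 4) + 1                ≡⟨ sym (+3≡⇒+4≡+1 (b-regular n r′)) ⟩
      b n + 4                            ≡⟨ cong (_+ 4) (sym eq) ⟩
      a m + 4                            ≡⟨ a-even m t e ⟩
      lucas (oddIdx (suc t))             ≡⟨ sym (floorφ²-lucas-odd t) ⟩
      floorφ² (lucas (oddIdx t)) + 1     ∎)))
    where open ≡-Reasoning
  a≢b-even m n t e (oddLucas t′ e′) eq =
    lucas-nonconsecutive (oddIdx (suc t)) (oddIdx (suc t′)) (oddIdx≥3 (suc t′))
      (trans (sym (a-even m t e)) (trans (cong (_+ 4) eq) (+3≡⇒+4≡suc (b-odd n t′ e′))))
  a≢b-even m n t e (evenLucas t′ e′) eq =
    oddIdx≢evenIdx (suc t) (suc t′) (lucas-injective (s≤s z≤n) (s≤s z≤n)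
      (trans (sym (a-even m t e)) (trans (cong (_+ 4) eq) (b-even n t′ e′))))

  a≢b : ∀ m n → a m ≢ b n
  a≢b m n with shape m
  ... | regular r = a≢b-regular m n r (shape n)
  ... | oddLucas t e = a≢b-odd m n t e (shape n)
  ... | evenLucas t e = a≢b-even m n t e (shape n)

  Covered : ℕ → Set
  Covered k = (Σ ℕ λ n → k ≡ a n) ⊎ (Σ ℕ λ n → k ≡ b n)

  ≥4⇒≡+4 : ∀ {x} → 4 ≤ x → Σ ℕ λ n → n + 4 ≡ x
  ≥4⇒≡+4 {x} 4≤x = x ∸ 4 , m∸n+n≡m 4≤x

  covered-floorφ : ∀ k n → 4 ≤ k → k + 3 ≡ floorφ (n + 4) → Covered k
  covered-floorφ k n 4≤k eq with shape n
  ... | regular r = inj₁ (n , +-cancelʳ-≡ 3 _ _ (trans eq (sym (a-regular n r))))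
  ... | oddLucas zero e = ⊥-elim (<-irrefl (sym k≡3) 4≤k)
    where
    k≡3 : k ≡ 3
    k≡3 = +-cancelʳ-≡ 4 k 3 (trans (+3≡⇒+4≡+1 eq) (trans (cong (λ j → floorφ j + 1) e) (floorφ-lucas-odd zero)))
  ... | oddLucas (suc u) e with ≥4⇒≡+4 (lucas-evenIdx≥4 u)
  ...   | n′ , e′ = inj₂ (n′ , +-cancelʳ-≡ 4 _ _ (begin
    k + 4                                ≡⟨ +3≡⇒+4≡+1 eq ⟩
    floorφ (n + 4) + 1                   ≡⟨ cong (λ j → floorφ j + 1) e ⟩
    floorφ (lucas (oddIdx (suc u))) + 1  ≡⟨ floorφ-lucas-odd (suc u) ⟩
    lucas (evenIdx (suc u))              ≡⟨ sym (b-even n′ u e′) ⟩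
    b n′ + 4                             ∎))
    where open ≡-Reasoning
  covered-floorφ k n 4≤k eq | evenLucas t e with ≥4⇒≡+4 (lucas-oddIdx≥4 t)
  ...   | n′ , e′ = inj₂ (n′ , +-cancelʳ-≡ 3 _ _ (begin
    k + 3                        ≡⟨ trans eq (cong floorφ e) ⟩
    floorφ (lucas (evenIdx t))   ≡⟨ floorφ-lucas-even t ⟩
    lucas (oddIdx (suc t))       ≡⟨ sym (b-odd n′ t e′) ⟩
    b n′ + 3                     ∎))
    where open ≡-Reasoning

  covered-floorφ² : ∀ k n → k + 3 ≡ floorφ² (n + 4) → Covered k
  covered-floorφ² k n eq with shape n
  ... | regular r = inj₂ (n , +-cancelʳ-≡ 3 _ _ (trans eq (sym (b-regular n r))))
  ... | oddLucas t e with ≥4⇒≡+4 (lucas-evenIdx≥4 t)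
  ...   | n′ , e′ = inj₁ (n′ , +-cancelʳ-≡ 4 _ _ (begin
    k + 4                            ≡⟨ +3≡⇒+4≡+1 eq ⟩
    floorφ² (n + 4) + 1              ≡⟨ cong (λ j → floorφ² j + 1) e ⟩
    floorφ² (lucas (oddIdx t)) + 1   ≡⟨ floorφ²-lucas-odd t ⟩
    lucas (oddIdx (suc t))           ≡⟨ sym (a-even n′ t e′) ⟩
    a n′ + 4                         ∎))
    where open ≡-Reasoning
  covered-floorφ² k n eq | evenLucas t e with ≥4⇒≡+4 (lucas-oddIdx≥4 (suc t))
  ...   | n′ , e′ = inj₁ (n′ , +-cancelʳ-≡ 3 _ _ (begin
    k + 3                         ≡⟨ trans eq (cong floorφ² e) ⟩
    floorφ² (lucas (evenIdx t))   ≡⟨ floorφ²-lucas-even t ⟩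
    lucas (evenIdx (suc t))       ≡⟨ sym (a-odd n′ (suc t) e′) ⟩
    a n′ + 3                      ∎))
    where open ≡-Reasoning

  covered : ∀ k → 4 ≤ k → Covered k
  covered k 4≤k with beatty-cover (k + 2)
  ... | d , k+3≡ = from-index d (subst (λ x → (x ≡ floorφ (suc d)) ⊎ (x ≡ floorφ² (suc d))) (sym (+-suc k 2))
                                     k+3≡)
    where
    small : ∀ {c} → k + 3 ≡ c → c < 7 → ⊥
    small eq c<7 = <-irrefl refl (<-≤-trans c<7 (subst (7 ≤_) eq (+-monoˡ-≤ 3 4≤k)))
    from-index : ∀ d → (k + 3 ≡ floorφ (suc d)) ⊎ (k + 3 ≡ floorφ² (suc d)) → Covered k
    from-index zero (inj₁ eq) = ⊥-elim (small eq (s≤s (s≤s z≤n)))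
    from-index zero (inj₂ eq) = ⊥-elim (small eq (s≤s (s≤s (s≤s z≤n))))
    from-index (suc zero) (inj₁ eq) = ⊥-elim (small eq (s≤s (s≤s (s≤s (s≤s z≤n)))))
    from-index (suc zero) (inj₂ eq) = ⊥-elim (small eq (s≤s (s≤s (s≤s (s≤s (s≤s (s≤s z≤n)))))))
    from-index (suc (suc zero)) (inj₁ eq) = ⊥-elim (small eq (s≤s (s≤s (s≤s (s≤s (s≤s z≤n))))))
    from-index (suc (suc zero)) (inj₂ eq) = inj₁ (0 , +-cancelʳ-≡ 3 k 4 eq)
    from-index (suc (suc (suc n))) (inj₁ eq) = covered-floorφ k n 4≤k (trans eq (cong floorφ (+-comm 4 n)))
    from-index (suc (suc (suc n))) (inj₂ eq) = covered-floorφ² k n (trans eq (cong floorφ² (+-comm 4 n)))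

module WythoffGame where

  open import Data.Nat using (ℕ; zero; suc; _+_; _∸_; _≤_; _<_; s≤s; z≤n; _⊓_; _≤ᵇ_)
  open import Data.Nat.Properties
  open import Data.Nat.Tactic.RingSolver using (solve-∀)
  open import Data.Product using (Σ; _,_; proj₁; proj₂; _×_)
  open import Data.Sum using (_⊎_; inj₁; inj₂)
  open import Data.Bool using (Bool; true; false; not; T)
  open import Data.List using (List; []; _∷_; map; upTo; _++_)
  open import Data.List.Membership.Propositional using (_∈_)
  open import Data.List.Membership.Propositional.Properties
    using (∈-++⁻; ∈-++⁺ˡ; ∈-++⁺ʳ; ∈-map⁻; ∈-map⁺; ∈-upTo⁻; ∈-upTo⁺)
  open import Data.List.Relation.Unary.Any using (here; there)
  open import Data.Empty using (⊥; ⊥-elim)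
  open import Relation.Nullary using (yes; no)
  open import Relation.Binary.Definitions using (tri<; tri≈; tri>)
  open import Data.Bool.Properties using (T-≡)
  open import Relation.Binary.PropositionalEquality
  open import Function.Bundles using (_⇔_; mk⇔; Equivalence)
  open StrictMonotonicity

  Move : ℕ → ℕ → ℕ → ℕ → Set
  Move x y x′ y′ = ((y′ ≡ y) × (x′ < x))
                 ⊎ ((x′ ≡ x) × (y′ < y))
                 ⊎ (Σ ℕ λ k → (1 ≤ k) × (x ≡ x′ + k) × (y ≡ y′ + k))

  Move-swap : ∀ {x y x′ y′} → Move x y x′ y′ → Move y x y′ x′
  Move-swap (inj₁ (e , lt)) = inj₂ (inj₁ (e , lt))
  Move-swap (inj₂ (inj₁ (e , lt))) = inj₁ (e , lt)
  Move-swap (inj₂ (inj₂ (k , 1≤k , e₁ , e₂))) = inj₂ (inj₂ (k , 1≤k , e₂ , e₁))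

  Move-decreasing : ∀ {x y x′ y′} → Move x y x′ y′ → x′ + y′ < x + y
  Move-decreasing {x} {y} (inj₁ (refl , x′<x)) = +-monoˡ-< y x′<x
  Move-decreasing {x} {y} (inj₂ (inj₁ (refl , y′<y))) = +-monoʳ-< x y′<y
  Move-decreasing {x′ = x′} {y′} (inj₂ (inj₂ (k , 1≤k , refl , refl))) =
    +-mono-≤-< (m≤m+n x′ k) (m<m+n y′ 1≤k)

  ∸-suc-< : ∀ x i → i < x → x ∸ suc i < x
  ∸-suc-< (suc x) i (s≤s _) = s≤s (m∸n≤m x i)

  ∸-suc-∸-suc : ∀ x x′ → x′ < x → x ∸ suc (x ∸ suc x′) ≡ x′
  ∸-suc-∸-suc (suc x) x′ (s≤s x′≤x) = m∸[m∸n]≡n x′≤x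

  horizontalMoves verticalMoves diagonalMoves : ℕ → ℕ → List (ℕ × ℕ)
  horizontalMoves x y = map (λ i → (x ∸ suc i , y)) (upTo x)
  verticalMoves x y = map (λ i → (x , y ∸ suc i)) (upTo y)
  diagonalMoves x y = map (λ i → (x ∸ suc i , y ∸ suc i)) (upTo (x ⊓ y))

  ∈-wythoffMoves⇒Move : ∀ {x y p} → p ∈ wythoffMoves x y → Move x y (proj₁ p) (proj₂ p)
  ∈-wythoffMoves⇒Move {x} {y} p∈ with ∈-++⁻ (horizontalMoves x y) p∈
  ... | inj₁ p∈ₕ with ∈-map⁻ (λ i → (x ∸ suc i , y)) p∈ₕ
  ...   | i , i∈ , refl = inj₁ (refl , ∸-suc-< x i (∈-upTo⁻ i∈))
  ∈-wythoffMoves⇒Move {x} {y} p∈ | inj₂ p∈ᵥ₊d with ∈-++⁻ (verticalMoves x y) p∈ᵥ₊d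
  ... | inj₁ p∈ᵥ with ∈-map⁻ (λ i → (x , y ∸ suc i)) p∈ᵥ
  ...   | i , i∈ , refl = inj₂ (inj₁ (refl , ∸-suc-< y i (∈-upTo⁻ i∈)))
  ∈-wythoffMoves⇒Move {x} {y} p∈ | inj₂ _ | inj₂ p∈d with ∈-map⁻ (λ i → (x ∸ suc i , y ∸ suc i)) p∈d
  ...   | i , i∈ , refl =
    inj₂ (inj₂ (suc i , s≤s z≤n , sym (m∸n+n≡m (≤-trans i<x⊓y (m⊓n≤m x y))) , sym (m∸n+n≡m (≤-trans i<x⊓y (m⊓n≤n x y)))))
    where
    i<x⊓y : suc i ≤ x ⊓ y
    i<x⊓y = ∈-upTo⁻ i∈

  Move⇒∈-wythoffMoves : ∀ {x y x′ y′} → Move x y x′ y′ → (x′ , y′) ∈ wythoffMoves x y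
  Move⇒∈-wythoffMoves {x} {y} {x′} {y′} (inj₁ (refl , x′<x)) =
    ∈-++⁺ˡ (subst (λ z → (z , y′) ∈ horizontalMoves x y′) (∸-suc-∸-suc x x′ x′<x)
             (∈-map⁺ (λ i → (x ∸ suc i , y′)) (∈-upTo⁺ (∸-suc-< x x′ x′<x))))
  Move⇒∈-wythoffMoves {x} {y} {x′} {y′} (inj₂ (inj₁ (refl , y′<y))) =
    ∈-++⁺ʳ (horizontalMoves x′ y)
      (∈-++⁺ˡ (subst (λ z → (x′ , z) ∈ verticalMoves x′ y) (∸-suc-∸-suc y y′ y′<y)
                (∈-map⁺ (λ i → (x′ , y ∸ suc i)) (∈-upTo⁺ (∸-suc-< y y′ y′<y)))))
  Move⇒∈-wythoffMoves {x′ = x′} {y′} (inj₂ (inj₂ (suc k , _ , refl , refl))) =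
    ∈-++⁺ʳ (horizontalMoves x y) (∈-++⁺ʳ (verticalMoves x y)
      (subst₂ (λ u v → (u , v) ∈ diagonalMoves x y) (m+n∸n≡m x′ (suc k)) (m+n∸n≡m y′ (suc k))
        (∈-map⁺ (λ i → (x ∸ suc i , y ∸ suc i)) (∈-upTo⁺ k<⊓))))
    where
    x = x′ + suc k
    y = y′ + suc k
    k<⊓ : k < x ⊓ y
    k<⊓ = ⊓-glb (m≤n+m (suc k) x′) (m≤n+m (suc k) y′)

  allB-sound : ∀ {A : Set} (p : A → Bool) xs → allB p xs ≡ true → ∀ {z} → z ∈ xs → p z ≡ true
  allB-sound p (x ∷ xs) h (here refl) with p x | h
  ... | true | _ = refl
  allB-sound p (x ∷ xs) h (there z∈) with p x | h
  ... | true | h′ = allB-sound p xs h′ z∈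

  allB-complete : ∀ {A : Set} (p : A → Bool) xs → (∀ {z} → z ∈ xs → p z ≡ true) → allB p xs ≡ true
  allB-complete p [] _ = refl
  allB-complete p (x ∷ xs) all rewrite all (here refl) = allB-complete p xs (λ z∈ → all (there z∈))

  module Characterisation
    (ℓ : ℕ) (a : ℕ → ℕ)
    (a-<-suc : ∀ n → a n < a (suc n))
    (ℓ<a₀ : ℓ < a 0)
    (a≢b : ∀ m n → a m ≢ a n + n + suc ℓ)
    (covered : ∀ k → ℓ < k → (Σ ℕ λ n → k ≡ a n) ⊎ (Σ ℕ λ n → k ≡ a n + n + suc ℓ))
    where

    b : ℕ → ℕ
    b n = a n + n + suc ℓ

    a-mono-< : ∀ {m n} → m < n → a m < a n
    a-mono-< = mono-suc⇒mono a a-<-suc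

    a-injective : ∀ {m n} → a m ≡ a n → m ≡ n
    a-injective = mono⇒injective a a-mono-<

    b-injective : ∀ {m n} → b m ≡ b n → m ≡ n
    b-injective = mono⇒injective b (λ m<n → +-monoˡ-< (suc ℓ) (+-mono-< (a-mono-< m<n) m<n))

    ℓ<a : ∀ n → ℓ < a n
    ℓ<a zero = ℓ<a₀
    ℓ<a (suc n) = <-trans (ℓ<a n) (a-<-suc n)

    a<b : ∀ n → a n < b n
    a<b n = <-≤-trans (m<m+n (a n) (s≤s z≤n)) (+-monoˡ-≤ (suc ℓ) (m≤m+n (a n) n))

    ℓ<b : ∀ n → ℓ < b n
    ℓ<b n = <-trans (ℓ<a n) (a<b n)

    Candidate : ℕ → ℕ → Set
    Candidate x y = (x + y ≤ ℓ)
                  ⊎ (Σ ℕ λ n → (x ≡ a n) × (y ≡ b n))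
                  ⊎ (Σ ℕ λ n → (x ≡ b n) × (y ≡ a n))

    Candidate-swap : ∀ {x y} → Candidate x y → Candidate y x
    Candidate-swap {x} {y} (inj₁ x+y≤ℓ) = inj₁ (subst (_≤ ℓ) (+-comm x y) x+y≤ℓ)
    Candidate-swap (inj₂ (inj₁ (n , e₁ , e₂))) = inj₂ (inj₂ (n , e₂ , e₁))
    Candidate-swap (inj₂ (inj₂ (n , e₁ , e₂))) = inj₂ (inj₁ (n , e₂ , e₁))

    ≤ℓ-absurd : ∀ {x y} → ℓ < y → x + y ≤ ℓ → ⊥
    ≤ℓ-absurd {x} ℓ<y x+y≤ℓ = <-irrefl refl (<-≤-trans ℓ<y (≤-trans (m≤n+m _ x) x+y≤ℓ))

    no-diagonal-move : ∀ n {x′ y′} k → 1 ≤ k → a n ≡ x′ + k → b n ≡ y′ + k → Candidate x′ y′ → ⊥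
    no-diagonal-move n {x′} {y′} k 1≤k eₐ e_b candidate = excluded candidate
      where
      y′≡ : y′ ≡ x′ + (n + suc ℓ)
      y′≡ = +-cancelʳ-≡ k _ _ (trans (sym e_b)
              (trans (+-assoc (a n) n (suc ℓ)) (trans (cong (_+ (n + suc ℓ)) eₐ) (ring x′ k (n + suc ℓ)))))
        where
        ring : ∀ x k d → x + k + d ≡ x + d + k
        ring = solve-∀
      excluded : Candidate x′ y′ → ⊥
      excluded (inj₁ x′+y′≤ℓ) =
        ≤ℓ-absurd {x′} (≤-trans (m≤n+m (suc ℓ) n) (≤-trans (m≤n+m _ x′) (≤-reflexive (sym y′≡))))
                  x′+y′≤ℓ
      excluded (inj₂ (inj₁ (m , e₁ , e₂))) =
        <-irrefl refl (<-≤-trans (m<m+n x′ 1≤k) (≤-reflexive (trans (sym eₐ) (sym x′≡aₙ))))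
        where
        m≡n : m ≡ n
        m≡n = +-cancelʳ-≡ (suc ℓ) m n (+-cancelˡ-≡ x′ (m + suc ℓ) (n + suc ℓ)
                (trans (cong (_+ (m + suc ℓ)) e₁) (trans (sym (+-assoc (a m) m (suc ℓ))) (trans (sym e₂) y′≡))))
        x′≡aₙ : x′ ≡ a n
        x′≡aₙ = trans e₁ (cong a m≡n)
      excluded (inj₂ (inj₂ (m , e₁ , e₂))) =
        <-irrefl refl (<-≤-trans (a<b m) (≤-trans (≤-reflexive (sym e₁))
                                         (≤-trans (m≤m+n x′ (n + suc ℓ)) (≤-reflexive (trans (sym y′≡) e₂)))))

    no-move-from-pair : ∀ n {x′ y′} → Move (a n) (b n) x′ y′ → Candidate x′ y′ → ⊥
    no-move-from-pair n {x′} (inj₁ (refl , x′<a)) (inj₁ x′+b≤ℓ) = ≤ℓ-absurd {x′} (ℓ<b n) x′+b≤ℓ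
    no-move-from-pair n (inj₁ (refl , x′<a)) (inj₂ (inj₁ (m , e₁ , e₂))) =
      <-irrefl (trans e₁ (cong a (sym (b-injective e₂)))) x′<a
    no-move-from-pair n (inj₁ (refl , x′<a)) (inj₂ (inj₂ (m , e₁ , e₂))) = a≢b m n (sym e₂)
    no-move-from-pair n {y′ = y′} (inj₂ (inj₁ (refl , y′<b))) (inj₁ a+y′≤ℓ) =
      ≤ℓ-absurd {y′} (ℓ<a n) (subst (_≤ ℓ) (+-comm (a n) y′) a+y′≤ℓ)
    no-move-from-pair n (inj₂ (inj₁ (refl , y′<b))) (inj₂ (inj₁ (m , e₁ , e₂))) =
      <-irrefl (trans e₂ (cong b (sym (a-injective e₁)))) y′<b
    no-move-from-pair n (inj₂ (inj₁ (refl , y′<b))) (inj₂ (inj₂ (m , e₁ , e₂))) = a≢b n m e₁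
    no-move-from-pair n (inj₂ (inj₂ (k , 1≤k , eₐ , e_b))) = no-diagonal-move n k 1≤k eₐ e_b

    Candidate-no-move : ∀ {x y x′ y′} → Candidate x y → ℓ < x + y → Move x y x′ y′ → Candidate x′ y′ → ⊥
    Candidate-no-move (inj₁ x+y≤ℓ) ℓ<x+y _ _ = <-irrefl refl (<-≤-trans ℓ<x+y x+y≤ℓ)
    Candidate-no-move (inj₂ (inj₁ (n , refl , refl))) _ move candidate = no-move-from-pair n move candidate
    Candidate-no-move (inj₂ (inj₂ (n , refl , refl))) _ move candidate =
      no-move-from-pair n (Move-swap move) (Candidate-swap candidate)

    CandidateOrMove : ℕ → ℕ → Set
    CandidateOrMove x y = Candidate x y ⊎ (Σ ℕ λ x′ → Σ ℕ λ y′ → Move x y x′ y′ × Candidate x′ y′)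

    diagonal-to-pair : ∀ n y → a n ≤ y → y < b n → ℓ < y ∸ a n → CandidateOrMove (a n) y
    diagonal-to-pair n y aₙ≤y y<bₙ ℓ<d =
      inj₂ (a m , b m , inj₂ (inj₂ (a n ∸ a m , m<n⇒0<n∸m aₘ<aₙ , aₙ≡ , y≡)) ,
            inj₂ (inj₁ (m , refl , refl)))
      where
      d = y ∸ a n
      m = d ∸ suc ℓ
      m+ℓ+1≡d : m + suc ℓ ≡ d
      m+ℓ+1≡d = m∸n+n≡m ℓ<d
      y≡aₙ+d : y ≡ a n + d
      y≡aₙ+d = sym (m+[n∸m]≡n aₙ≤y)
      m<n : m < n
      m<n = +-cancelʳ-< (suc ℓ) m n (subst (_< n + suc ℓ) (sym m+ℓ+1≡d)
              (+-cancelˡ-< (a n) _ _ (subst₂ _<_ y≡aₙ+d (+-assoc (a n) n (suc ℓ)) y<bₙ)))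
      aₘ<aₙ : a m < a n
      aₘ<aₙ = a-mono-< m<n
      aₙ≡ : a n ≡ a m + (a n ∸ a m)
      aₙ≡ = sym (m+[n∸m]≡n (<⇒≤ aₘ<aₙ))
      y≡ : y ≡ b m + (a n ∸ a m)
      y≡ = trans y≡aₙ+d (trans (cong (_+ d) aₙ≡)
             (trans (cong (λ z → a m + (a n ∸ a m) + z) (sym m+ℓ+1≡d)) (ring (a m) (a n ∸ a m) m (suc ℓ))))
        where
        ring : ∀ x k m s → x + k + (m + s) ≡ x + m + s + k
        ring = solve-∀

    move-to-candidate-≤ : ∀ x y → x ≤ y → ℓ < x + y → CandidateOrMove x y
    move-to-candidate-≤ x y x≤y ℓ<x+y with x ≤? ℓ
    ... | yes x≤ℓ = inj₂ (x , 0 , inj₂ (inj₁ (refl , 0<y y ℓ<x+y)) , inj₁ x+0≤ℓ)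
      where
      x+0≤ℓ : x + 0 ≤ ℓ
      x+0≤ℓ = subst (_≤ ℓ) (sym (+-identityʳ x)) x≤ℓ
      0<y : ∀ y → ℓ < x + y → 0 < y
      0<y zero ℓ<x+0 = ⊥-elim (<-irrefl refl (<-≤-trans ℓ<x+0 x+0≤ℓ))
      0<y (suc _) _ = s≤s z≤n
    ... | no x≰ℓ with y ∸ x ≤? ℓ
    ...   | yes d≤ℓ =
      inj₂ (0 , y ∸ x , inj₂ (inj₂ (x , ≤-trans (s≤s z≤n) (≰⇒> x≰ℓ) , refl , sym (m∸n+n≡m x≤y))) ,
            inj₁ d≤ℓ)
    ...   | no d≰ℓ with covered x (≰⇒> x≰ℓ)
    ...     | inj₂ (n , refl) =
      inj₂ (b n , a n , inj₂ (inj₁ (refl , <-≤-trans (a<b n) x≤y)) , inj₂ (inj₂ (n , refl , refl)))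
    ...     | inj₁ (n , refl) with <-cmp y (b n)
    ...       | tri< y<b _ _ = diagonal-to-pair n y x≤y y<b (≰⇒> d≰ℓ)
    ...       | tri≈ _ refl _ = inj₁ (inj₂ (inj₁ (n , refl , refl)))
    ...       | tri> _ _ b<y = inj₂ (a n , b n , inj₂ (inj₁ (refl , b<y)) , inj₂ (inj₁ (n , refl , refl)))

    move-to-candidate : ∀ x y → ℓ < x + y → CandidateOrMove x y
    move-to-candidate x y ℓ<x+y with x ≤? y
    ... | yes x≤y = move-to-candidate-≤ x y x≤y ℓ<x+y
    ... | no x≰y with move-to-candidate-≤ y x (<⇒≤ (≰⇒> x≰y)) (subst (ℓ <_) (+-comm x y) ℓ<x+y)
    ...   | inj₁ candidate = inj₁ (Candidate-swap candidate)
    ...   | inj₂ (x′ , y′ , move , candidate) = inj₂ (y′ , x′ , Move-swap move , Candidate-swap candidate)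


    isPFuel-sound : ∀ f x y → x + y ≤ f → isPFuel ℓ f x y ≡ true → Candidate x y
    isPFuel-complete : ∀ f x y → x + y ≤ f → Candidate x y → isPFuel ℓ f x y ≡ true
    isPFuel-sound zero x y x+y≤0 _ = inj₁ (≤-trans x+y≤0 z≤n)
    isPFuel-sound (suc f) x y x+y≤f+1 isP with (x + y) ≤ᵇ ℓ in terminal
    ... | true = inj₁ (≤ᵇ⇒≤ (x + y) ℓ (Equivalence.from T-≡ terminal))
    ... | false with move-to-candidate x y (≰⇒> λ x+y≤ℓ → subst T terminal (≤⇒≤ᵇ x+y≤ℓ))
    ...   | inj₁ candidate = candidate
    ...   | inj₂ (x′ , y′ , move , candidate)
            with allB-sound (λ p → not (isPFuel ℓ f (proj₁ p) (proj₂ p))) (wythoffMoves x y) isP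
                            (Move⇒∈-wythoffMoves move)
    ...     | notP rewrite isPFuel-complete f x′ y′ (≤-pred (<-≤-trans (Move-decreasing move) x+y≤f+1)) candidate
      with notP
    ...       | ()
    isPFuel-complete zero x y _ _ = refl
    isPFuel-complete (suc f) x y x+y≤f+1 candidate with (x + y) ≤ᵇ ℓ in terminal
    ... | true = refl
    ... | false = allB-complete (λ p → not (isPFuel ℓ f (proj₁ p) (proj₂ p))) (wythoffMoves x y) no-P-option
      where
      ℓ<x+y : ℓ < x + y
      ℓ<x+y = ≰⇒> λ x+y≤ℓ → subst T terminal (≤⇒≤ᵇ x+y≤ℓ)
      no-P-option : ∀ {p} → p ∈ wythoffMoves x y → not (isPFuel ℓ f (proj₁ p) (proj₂ p)) ≡ true
      no-P-option {p} p∈ with isPFuel ℓ f (proj₁ p) (proj₂ p) in isP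
      ... | false = refl
      ... | true = ⊥-elim (Candidate-no-move candidate ℓ<x+y move
                     (isPFuel-sound f (proj₁ p) (proj₂ p) (≤-pred (<-≤-trans (Move-decreasing move) x+y≤f+1))
                                    isP))
        where
        move : Move x y (proj₁ p) (proj₂ p)
        move = ∈-wythoffMoves⇒Move {x} {y} p∈

    nonTerminalP⇔ : ∀ x y → x < y → (NonTerminalP ℓ x y ⇔ Σ ℕ λ n → (x ≡ a n) × (y ≡ b n))
    nonTerminalP⇔ x y x<y = mk⇔ to from
      where
      to : NonTerminalP ℓ x y → Σ ℕ λ n → (x ≡ a n) × (y ≡ b n)
      to (ℓ<x+y , isP) with isPFuel-sound (x + y) x y ≤-refl isP
      ... | inj₁ x+y≤ℓ = ⊥-elim (<-irrefl refl (<-≤-trans ℓ<x+y x+y≤ℓ))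
      ... | inj₂ (inj₁ pair) = pair
      ... | inj₂ (inj₂ (n , refl , refl)) = ⊥-elim (<-irrefl refl (<-trans x<y (a<b n)))
      from : (Σ ℕ λ n → (x ≡ a n) × (y ≡ b n)) → NonTerminalP ℓ x y
      from (n , refl , refl) =
        <-≤-trans (ℓ<a n) (m≤m+n (a n) (b n)) ,
        isPFuel-complete (a n + b n) (a n) (b n) ≤-refl (inj₂ (inj₁ (n , refl , refl)))

open import Data.Nat using (ℕ; suc; _+_; _<_; s≤s; z≤n)
open import Data.Nat.Properties using (m≤n+m; ≤-trans)
open import Data.Fin using (Fin; toℕ)
open import Data.Product using (Σ; _×_; _,_)
open import Function.Bundles using (_⇔_)
open import Relation.Binary.PropositionalEquality using (_≡_)
open FloorsOfMultiples
open FloorSequence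
open LucasAutomaton
open PerturbedSequence
open Partition
open WythoffGame

theorem13 : Σ (DFAO (Fin 3)) λ M →
    Σ (ℕ → ℕ) λ a → Σ (ℕ → ℕ) λ b →
      (∀ n → a n < a (suc n))
      × (∀ x y → x < y → (NonTerminalP 3 x y ⇔ Σ ℕ λ n → (x ≡ a n) × (y ≡ b n)))
      × (∀ n → Σ ℕ λ u → IsFloorPhiMul (n + 2) u
                × (a n + 1 ≡ u + toℕ (evalF M (n + 1))))
      × (∀ n → Σ ℕ λ v → IsFloorPhiSqMul (n + 2) v
                × (b n ≡ v + toℕ (evalF M (n + 1)) + 1))
theorem13 = automaton , a , b , a-<-suc , nonTerminalP⇔ ,
  (λ n → floorφ (n + 2) , Floorφ⇒IsFloorPhiMul (⌊[n+2]φ⌋ n) , a+1 n) ,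
  (λ n → floorφ² (n + 2) , Floorφ⇒IsFloorPhiSqMul (⌊[n+2]φ⌋ n) , b-formula n)
  where
  open Characterisation 3 a a-<-suc (s≤s (s≤s (s≤s (s≤s z≤n)))) a≢b covered using (nonTerminalP⇔)
  ⌊[n+2]φ⌋ : ∀ n → Floorφ (n + 2) (floorφ (n + 2))
  ⌊[n+2]φ⌋ n = floorφ-spec (≤-trans (s≤s z≤n) (m≤n+m 2 n))
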